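{- Let $q=p^t$ with $p$ an odd prime and $t\ge0$ an integer, and let $n=r\cdot q$ with $r$ a positive integer. Suppose there is a nonessential element $j\in[n-1]$ that is not divisible by $q$. Suppose moreover that there exist integers $a$ and $b$, neither divisible by $p$, with $a\equiv b\bmod 2$, such that for all $S\subseteq[n-1]$, $\beta_n(S)$ is congruent to $a$ or to $b$ modulo $p$. Then $$|\{S\subseteq[n-1]:\beta_n(S)\equiv a\bmod 2p\}|=|\{S\subseteq[n-1]:\beta_n(S)\equiv b\bmod 2p\}|,$$ $$|\{S\subseteq[n-1]:\beta_n(S)\equiv a+p\bmod 2p\}|=|\{S\subseteq[n-1]:\beta_n(S)\equiv b+p\bmod 2p\}|.$$ Furthermore, if $\rho(n)=1/2$, then all four of these cardinalities equal $2^{n-3}$.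
   Context: For $S\subseteq[n-1]=\{1,\dots,n-1\}$, $\beta_n(S)$ is the number of permutations $\pi\in\mathfrak{S}_n$ with descent set $\{i:\pi_i>\pi_{i+1}\}$ equal to $S$. $\rho(n)=|\{S\subseteq[n-1]:\beta_n(S)\text{ odd}\}|/2^{n-1}$. Writing $n=2^{j_1}+\cdots+2^{j_k}$ with $j_1>\cdots>j_k\ge0$, an element of $[n-1]$ is essential if it equals $\sum_{i\in B}2^{j_i}$ for some nonempty proper subset $B\subseteq\{1,\dots,k\}$, and nonessential otherwise. -}

module Defs where

open import Data.Bool using (Bool; true; false; if_then_else_)
import Data.Bool.Properties as BoolP
open import Data.Nat using (ℕ; zero; suc; _+_; _*_; _∸_; _^_; _<ᵇ_; _≤_; _<_; pred)
import Data.Nat.Properties as ℕP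
open import Data.Nat.DivMod using (_/_; _%_)
open import Data.Nat.Divisibility using (_∣?_)
open import Data.Integer as ℤ using (ℤ; +_; _-_)
open import Data.Integer.Divisibility using (_∣_)
open import Data.Fin using (Fin; toℕ; _<?_)
open import Data.List as List using (List; []; _∷_; length; filter; upTo; allFin; concatMap; map; sum)
open import Data.List.Relation.Unary.Unique.Propositional using (Unique)
open import Data.List.Relation.Unary.Unique.DecPropositional using (unique?)
open import Data.Vec as Vec using (Vec; []; _∷_; toList)
import Data.Vec.Properties as VecP
open import Data.Product using (Σ; _×_; _,_; ∃)
open import Relation.Nullary using (¬_; Dec)
open import Relation.Nullary.Decidable using (_×-dec_)
open import Relation.Binary.PropositionalEquality using (_≡_; _≢_)
open import Data.Rational using (ℚ) renaming (_/_ to _/ℚ_)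

allVecs : {A : Set} → List A → (m : ℕ) → List (Vec A m)
allVecs xs zero    = [] ∷ []
allVecs xs (suc m) = concatMap (λ x → map (x ∷_) (allVecs xs m)) xs

-- A permutation of [n] (0-indexed as Fin n) in one-line notation
-- is a vector π = (π₁,…,πₙ) of elements of Fin n with no repetitions.
IsPerm : {n : ℕ} → Vec (Fin n) n → Set
IsPerm π = Unique (toList π)

isPerm? : {n : ℕ} → (π : Vec (Fin n) n) → Dec (IsPerm π)
isPerm? π = unique? Data.Fin._≟_ (toList π)

-- Subsets of [n-1] = {1,…,n-1} as characteristic vectors of length n-1:
-- position k (0-indexed) represents the element k+1.
SubsetOf[n-1] : ℕ → Set
SubsetOf[n-1] n = Vec Bool (pred n)

allSubsets : (n : ℕ) → List (SubsetOf[n-1] n)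
allSubsets n = allVecs (true ∷ false ∷ []) (pred n)

-- Descent set of a word w₁…wₙ: position k (0-indexed, i.e. element k+1 of [n-1])
-- is marked iff w_{k+1} > w_{k+2} (1-indexed).
descentSet : {k n : ℕ} → Vec (Fin k) n → Vec Bool (pred n)
descentSet []            = []
descentSet (x ∷ [])      = []
descentSet (x ∷ y ∷ ws)  = (toℕ y <ᵇ toℕ x) ∷ descentSet (y ∷ ws)

β : (n : ℕ) → SubsetOf[n-1] n → ℕ
β n S = length (filter (λ π → isPerm? π ×-dec VecP.≡-dec BoolP._≟_ (descentSet π) S)
                       (allVecs (allFin n) n))

_≡_[mod_] : ℤ → ℤ → ℕ → Set
x ≡ y [mod m ] = (+ m) ∣ (x - y)

_≡?_[mod_] : (x y : ℤ) (m : ℕ) → Dec (x ≡ y [mod m ])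
x ≡? y [mod m ] = m ∣? ℤ.∣ x - y ∣

countCong : (n : ℕ) → ℤ → ℕ → ℕ
countCong n c m = length (filter (λ S → (+ β n S) ≡? c [mod m ]) (allSubsets n))

countOdd : ℕ → ℕ
countOdd n = length (filter (λ S → β n S % 2 Data.Nat.≟ 1) (allSubsets n))

ρ : ℕ → ℚ
ρ n = _/ℚ_ (+ countOdd n) (2 ^ (n ∸ 1)) {{ℕP.m^n≢0 2 (n ∸ 1)}}

-- Binary expansion: the exponents j₁,…,j_k with n = 2^{j₁}+⋯+2^{j_k}
-- (the bits of n; all lie below n).
binaryExponents : ℕ → List ℕ
binaryExponents n = filter (λ i → _/_ n (2 ^ i) {{ℕP.m^n≢0 2 i}} % 2 Data.Nat.≟ 1) (upTo n)

selectedSum : (js : List ℕ) → Vec Bool (length js) → ℕ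
selectedSum []       []        = 0
selectedSum (j ∷ js) (b ∷ bs)  = (if b then 2 ^ j else 0) + selectedSum js bs

NonemptySel : {m : ℕ} → Vec Bool m → Set
NonemptySel B = B ≢ Vec.replicate _ false

ProperSel : {m : ℕ} → Vec Bool m → Set
ProperSel B = B ≢ Vec.replicate _ true

Essential : ℕ → ℕ → Set
Essential n j = Σ (Vec Bool (length (binaryExponents n))) λ B →
  NonemptySel B × ProperSel B × j ≡ selectedSum (binaryExponents n) B

In[n-1] : ℕ → ℕ → Set
In[n-1] n j = 1 ≤ j × j < n

module Submission where

-- Let S′ be S with the membership of j toggled.  The permutations counted by β(S) + β(S′) are those
-- whose descent set agrees with S away from j.  Sorting them by the set of their first j values, an
-- adjacent transposition of values that separates this set from its complement preserves the relative
-- order inside both blocks, hence every descent except possibly the one at j; so all j-subsets carry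
-- the same number X of such permutations and β(S) + β(S′) = C(n,j)·X.  From j·C(n,j) = n·C(n−1,j−1),
-- p^t ∣ n and p^t ∤ j give p ∣ C(n,j); a nonessential j has a binary digit that n lacks, so C(n,j) is
-- even by Lucas' theorem mod 2.  Thus β(S) + β(S′) ≡ 0 (mod 2p).  Since β(S), β(S′) ∈ {a, b} mod p and
-- p ∤ 2a, 2b, this forces a + b ≡ 0 (mod p), hence (as a ≡ b mod 2) mod 2p, and S ↦ S′ exchanges the
-- classes a ↔ b and a+p ↔ b+p mod 2p.  The classes a, b share the parity of a, and a+p, b+p the other
-- parity; so when ρ(n) = 1/2 each pair covers 2^(n−2) sets and each class 2^(n−3).

module Combinatorics where

  open import Data.Bool using (Bool; true; false; not; if_then_else_; T)
  import Data.Bool.Properties as Bool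
  open import Data.Empty using (⊥-elim)
  open import Data.Fin using (Fin; zero; suc; toℕ)
  import Data.Fin as Fin
  open import Data.Fin.Subset using (Subset; ∣_∣)
  open import Data.Fin.Subset.Properties using (∣p∣≤n)
  open import Data.List using (List; []; _∷_; length; filter; map; _++_; concatMap; allFin; take; drop; applyUpTo; upTo)
  import Data.List
  open import Data.List.Membership.Propositional using (_∈_; _∉_)
  open import Data.List.Membership.Propositional.Properties
    using (∈-map⁺; ∈-map⁻; ∈-filter⁺; ∈-filter⁻; ∈-concatMap⁺; ∈-concatMap⁻; ∈-allFin; ∈-++⁺ʳ)
  open import Data.List.Membership.Propositional.Properties.WithK using (unique∧set⇒bag)
  open import Data.List.Properties using (length-map; map-cong; map-∘; map-++; ++-identityʳ; length-++)
  import Data.List.Properties as List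
  open import Data.List.Relation.Binary.BagAndSetEquality using (∼bag⇒↭)
  open import Data.List.Relation.Binary.Permutation.Propositional.Properties using (↭-length)
  import Data.List.Relation.Unary.All as All
  open import Data.List.Relation.Unary.AllPairs using ([]; _∷_)
  open import Data.List.Relation.Unary.Any using (here; there; any?)
  import Data.List.Relation.Unary.Any as Any
  open import Data.List.Relation.Unary.Unique.Propositional using (Unique)
  import Data.List.Relation.Unary.Unique.Propositional.Properties as Unique
  open import Data.Nat
    using (ℕ; zero; suc; pred; parity; ⌊_/2⌋; _/_; _%_; _+_; _*_; _∸_; _^_; _≡ᵇ_; _<ᵇ_; _≤_; _<_; s≤s; z≤n)
  import Data.Nat as ℕ
  open import Data.Nat.Combinatorics using (_C_; nCk+nC[k+1]≡[n+1]C[k+1]; nC1≡n)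
  open import Data.Nat.DivMod using (n/1≡n; m/n/o≡m/[n*o]; m/n≡1+[m∸n]/n; m≡m%n+[m/n]*n; m%n<n; m<n*o⇒m/o<n)
  open import Data.Nat.Divisibility
    using (_∣_; divides; _∣?_; ∣m∣n⇒∣m+n; ∣-trans; m∣m*n; ∣m⇒∣m*n; *-monoʳ-∣; *-cancelˡ-∣; 1∣_)
  open import Data.Nat.ListAction using (sum)
  open import Data.Nat.ListAction.Properties using (sum-++)
  open import Data.Nat.Primality using (Prime; euclidsLemma; prime⇒nonZero)
  import Data.Nat.Properties as ℕ
  open import Data.Nat.Tactic.RingSolver using (solve-∀)
  open import Algebra.Properties.CommutativeSemigroup ℕ.+-commutativeSemigroup
    using () renaming (interchange to +-interchange)
  open import Data.Parity.Base as ℙ using (0ℙ; 1ℙ)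
  open import Data.Parity.Properties using (+-homo-+; p≢p⁻¹) renaming (+-identityʳ to ℙ+-identityʳ)
  open import Data.Product using (_×_; _,_; proj₁; proj₂; ∃-syntax)
  open import Data.Sum using (_⊎_; inj₁; inj₂)
  open import Data.Unit using (tt)
  open import Data.Vec using (Vec; []; _∷_; head; lookup; toList; tabulate; replicate)
  import Data.Vec as Vec using (map)
  import Data.Vec.Properties as Vec
  open import Data.Vec.Relation.Binary.Equality.Cast using (cast-is-id)
  open import Defs
  open import Function.Bundles using (_⇔_; mk⇔; Equivalence)
  open import Level using (0ℓ)
  open import Relation.Binary.Definitions using (DecidableEquality)
  open import Relation.Binary.PropositionalEquality
  open import Relation.Nullary using (¬_; Dec; yes; no; does)
  open import Relation.Nullary.Decidable using (_×-dec_; dec-true; dec-false; does-⇔)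
  open import Relation.Unary using (Pred; Decidable)

  record Enumerates {A : Set} (xs : List A) : Set where
    field
      unique   : Unique xs
      complete : ∀ x → x ∈ xs

  open Enumerates

  private variable
    A : Set
    m : ℕ

  length-≡-if-same-elements : {xs ys : List A} → Unique xs → Unique ys →
    (∀ {x} → x ∈ xs ⇔ x ∈ ys) → length xs ≡ length ys
  length-≡-if-same-elements u v xs⇔ys = ↭-length (∼bag⇒↭ (unique∧set⇒bag u v xs⇔ys))

  unique-++⇒disjoint : ∀ {xs ys : List A} → Unique (xs ++ ys) → ∀ {v} → v ∈ xs → v ∉ ys
  unique-++⇒disjoint {xs = x ∷ xs} (x∉ ∷ _) (here refl) v∈ys = All.lookup x∉ (∈-++⁺ʳ xs v∈ys) refl
  unique-++⇒disjoint {xs = x ∷ xs} (_ ∷ u)  (there v∈)  v∈ys = unique-++⇒disjoint u v∈ v∈ys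

  length-filter-involution : {xs : List A} → Enumerates xs → (g : A → A) → (∀ x → g (g x) ≡ x) →
    {P Q : Pred A 0ℓ} (P? : Decidable P) (Q? : Decidable Q) →
    (∀ x → P x → Q (g x)) → (∀ x → Q x → P (g x)) →
    length (filter P? xs) ≡ length (filter Q? xs)
  length-filter-involution {xs = xs} E g g∘g P? Q? P⇒Q Q⇒P = begin
    length (filter P? xs)         ≡⟨ length-map g (filter P? xs) ⟨
    length (map g (filter P? xs)) ≡⟨ length-≡-if-same-elements
                                       (Unique.map⁺ g-injective (Unique.filter⁺ P? {xs} (unique E)))
                                       (Unique.filter⁺ Q? {xs} (unique E)) (mk⇔ to from) ⟩
    length (filter Q? xs)         ∎
    where
    open ≡-Reasoning
    g-injective : ∀ {x y} → g x ≡ g y → x ≡ y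
    g-injective {x} {y} gx≡gy = trans (sym (g∘g x)) (trans (cong g gx≡gy) (g∘g y))
    to : ∀ {y} → y ∈ map g (filter P? xs) → y ∈ filter Q? xs
    to y∈ with x , x∈ , refl ← ∈-map⁻ g y∈ =
      ∈-filter⁺ Q? (complete E (g x)) (P⇒Q x (proj₂ (∈-filter⁻ P? {xs = xs} x∈)))
    from : ∀ {y} → y ∈ filter Q? xs → y ∈ map g (filter P? xs)
    from {y} y∈ = subst (_∈ map g (filter P? xs)) (g∘g y)
      (∈-map⁺ g (∈-filter⁺ P? (complete E (g y)) (Q⇒P y (proj₂ (∈-filter⁻ Q? {xs = xs} y∈)))))

  length-filter-⊎ : {P Q R : Pred A 0ℓ} (P? : Decidable P) (Q? : Decidable Q) (R? : Decidable R) →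
    (∀ x → R x → P x ⊎ Q x) → (∀ x → P x ⊎ Q x → R x) → (∀ x → P x → ¬ Q x) →
    ∀ xs → length (filter P? xs) + length (filter Q? xs) ≡ length (filter R? xs)
  length-filter-⊎ P? Q? R? R⇒P⊎Q P⊎Q⇒R P⇒¬Q [] = refl
  length-filter-⊎ P? Q? R? R⇒P⊎Q P⊎Q⇒R P⇒¬Q (x ∷ xs) with P? x | Q? x | R? x
  ... | yes p | yes q | _    = ⊥-elim (P⇒¬Q x p q)
  ... | yes _ | no _  | yes _ = cong suc ih
    where
    ih : length (filter P? xs) + length (filter Q? xs) ≡ length (filter R? xs)
    ih = length-filter-⊎ P? Q? R? R⇒P⊎Q P⊎Q⇒R P⇒¬Q xs
  ... | no _  | yes _ | yes _ = trans (ℕ.+-suc _ _) (cong suc ih)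
    where
    ih : length (filter P? xs) + length (filter Q? xs) ≡ length (filter R? xs)
    ih = length-filter-⊎ P? Q? R? R⇒P⊎Q P⊎Q⇒R P⇒¬Q xs
  ... | no _  | no _  | no _  = length-filter-⊎ P? Q? R? R⇒P⊎Q P⊎Q⇒R P⇒¬Q xs
  ... | yes p | no _  | no ¬r = ⊥-elim (¬r (P⊎Q⇒R x (inj₁ p)))
  ... | no _  | yes q | no ¬r = ⊥-elim (¬r (P⊎Q⇒R x (inj₂ q)))
  ... | no ¬p | no ¬q | yes r with R⇒P⊎Q x r
  ...   | inj₁ p = ⊥-elim (¬p p)
  ...   | inj₂ q = ⊥-elim (¬q q)

  sum-map-if : {P : Pred A 0ℓ} (P? : Decidable P) (c : ℕ) (xs : List A) →
    sum (map (λ x → if does (P? x) then c else 0) xs) ≡ length (filter P? xs) * c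
  sum-map-if P? c [] = refl
  sum-map-if P? c (x ∷ xs) with does (P? x)
  ... | true  = cong (c +_) (sum-map-if P? c xs)
  ... | false = sum-map-if P? c xs

  sum-map-0 : (xs : List A) → sum (map (λ _ → 0) xs) ≡ 0
  sum-map-0 []       = refl
  sum-map-0 (_ ∷ xs) = sum-map-0 xs

  sum-map-+ : {B : Set} (g h : B → ℕ) (bs : List B) →
    sum (map (λ b → g b + h b) bs) ≡ sum (map g bs) + sum (map h bs)
  sum-map-+ g h [] = refl
  sum-map-+ g h (b ∷ bs) = begin
    g b + h b + sum (map (λ b → g b + h b) bs)   ≡⟨ cong (g b + h b +_) (sum-map-+ g h bs) ⟩
    g b + h b + (sum (map g bs) + sum (map h bs)) ≡⟨ +-interchange (g b) (h b) _ _ ⟩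
    g b + sum (map g bs) + (h b + sum (map h bs)) ∎
    where open ≡-Reasoning

  length-filter≡sum : {P : Pred A 0ℓ} (P? : Decidable P) (xs : List A) →
    length (filter P? xs) ≡ sum (map (λ x → if does (P? x) then 1 else 0) xs)
  length-filter≡sum P? xs = sym (trans (sum-map-if P? 1 xs) (ℕ.*-identityʳ _))

  length-filter-≟ : {B : Set} (_≟_ : DecidableEquality B) {bs : List B} → Enumerates bs →
    (y : B) → length (filter (y ≟_) bs) ≡ 1
  length-filter-≟ _≟_ {bs} E y = length-≡-if-same-elements
    (Unique.filter⁺ (y ≟_) {bs} (unique E)) (All.[] ∷ []) (mk⇔ to from)
    where
    to : ∀ {x} → x ∈ filter (y ≟_) bs → x ∈ y ∷ []
    to x∈ = here (sym (proj₂ (∈-filter⁻ (y ≟_) {xs = bs} x∈)))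
    from : ∀ {x} → x ∈ y ∷ [] → x ∈ filter (y ≟_) bs
    from (here refl) = ∈-filter⁺ (y ≟_) (complete E y) refl

  length-filter-fibres : {B : Set} (_≟_ : DecidableEquality B) {bs : List B} → Enumerates bs →
    (f : A → B) {P : Pred A 0ℓ} (P? : Decidable P) (xs : List A) →
    length (filter P? xs) ≡ sum (map (λ b → length (filter (λ x → P? x ×-dec (f x ≟ b)) xs)) bs)
  length-filter-fibres _≟_ {bs} E f P? [] = sym (sum-map-0 bs)
  length-filter-fibres {A = A} {B = B} _≟_ {bs} E f {P} P? (x ∷ xs) = begin
    length (filter P? (x ∷ xs))
      ≡⟨ length-filter-∷ P? ⟩
    indicator (P? x) + length (filter P? xs)
      ≡⟨ cong₂ _+_ (sym (fibre-of x)) (length-filter-fibres _≟_ E f P? xs) ⟩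
    sum (map (λ b → indicator (P? x ×-dec (f x ≟ b))) bs) + sum (map (λ b → length (filter (Pb b) xs)) bs)
      ≡⟨ sum-map-+ _ _ bs ⟨
    sum (map (λ b → indicator (P? x ×-dec (f x ≟ b)) + length (filter (Pb b) xs)) bs)
      ≡⟨ cong sum (map-cong (λ b → sym (length-filter-∷ (Pb b))) bs) ⟩
    sum (map (λ b → length (filter (Pb b) (x ∷ xs))) bs)
      ∎
    where
    open ≡-Reasoning
    indicator : {X : Set} → Dec X → ℕ
    indicator d = if does d then 1 else 0
    Pb : (b : B) → Decidable (λ y → P y × f y ≡ b)
    Pb b y = P? y ×-dec (f y ≟ b)
    length-filter-∷ : {Q : Pred A 0ℓ} (Q? : Decidable Q) →
      length (filter Q? (x ∷ xs)) ≡ indicator (Q? x) + length (filter Q? xs)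
    length-filter-∷ Q? with does (Q? x)
    ... | true  = refl
    ... | false = refl
    fibre-of : ∀ y → sum (map (λ b → indicator (P? y ×-dec (f y ≟ b))) bs) ≡ indicator (P? y)
    fibre-of y with P? y
    ... | no _  = sum-map-0 bs
    ... | yes _ = trans (sym (length-filter≡sum (f y ≟_) bs)) (length-filter-≟ _≟_ E (f y))

  Bool-enumerates : Enumerates (true ∷ false ∷ [])
  Bool-enumerates = record
    { unique   = ((λ ()) All.∷ All.[]) ∷ All.[] ∷ []
    ; complete = λ { true → here refl ; false → there (here refl) } }

  allFin-enumerates : ∀ n → Enumerates (allFin n)
  allFin-enumerates n = record { unique = Unique.allFin⁺ n ; complete = ∈-allFin }

  ∈-allVecs : {xs : List A} → (∀ x → x ∈ xs) → (v : Vec A m) → v ∈ allVecs xs m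
  ∈-allVecs complete []      = here refl
  ∈-allVecs {xs = xs} complete (x ∷ v) =
    ∈-concatMap⁺ _ {xs = xs} (Any.map (λ { refl → ∈-map⁺ (x ∷_) (∈-allVecs complete v) }) (complete x))

  unique-allVecs : {xs : List A} → Unique xs → ∀ m → Unique (allVecs xs m)
  unique-allVecs u zero    = All.[] ∷ []
  unique-allVecs {A = A} {xs = xs} u (suc m) = unique-prefixed xs u
    where
    V : List (Vec A m)
    V = allVecs xs m
    head-∈ : ∀ ys {v} → v ∈ concatMap (λ y → map (y ∷_) V) ys → head v ∈ ys
    head-∈ ys v∈ = Any.map (λ w∈ → let (_ , _ , v≡) = ∈-map⁻ _ w∈ in cong head v≡) (∈-concatMap⁻ _ {xs = ys} v∈)
    unique-prefixed : ∀ ys → Unique ys → Unique (concatMap (λ y → map (y ∷_) V) ys)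
    unique-prefixed []       _          = []
    unique-prefixed (y ∷ ys) (y∉ ∷ uys) =
      Unique.++⁺ (Unique.map⁺ Vec.∷-injectiveʳ (unique-allVecs u m)) (unique-prefixed ys uys)
        λ (v∈ , v∈′) → let (_ , _ , v≡) = ∈-map⁻ _ v∈ in All.lookup y∉ (head-∈ ys v∈′) (sym (cong head v≡))

  allVecs-enumerates : {xs : List A} → Enumerates xs → ∀ m → Enumerates (allVecs xs m)
  allVecs-enumerates E m = record { unique = unique-allVecs (unique E) m ; complete = ∈-allVecs (complete E) }

  length-allVecs : (xs : List A) → ∀ m → length (allVecs xs m) ≡ length xs ^ m
  length-allVecs xs zero    = refl
  length-allVecs xs (suc m) = go xs
    where
    go : ∀ ys → length (concatMap (λ y → map (y ∷_) (allVecs xs m)) ys) ≡ length ys * length xs ^ m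
    go []       = refl
    go (y ∷ ys) = trans (length-++ (map (y ∷_) (allVecs xs m)))
      (cong₂ _+_ (trans (length-map _ (allVecs xs m)) (length-allVecs xs m)) (go ys))

  subsets : ∀ m → List (Subset m)
  subsets = allVecs (true ∷ false ∷ [])

  sum-subsets-of-size : ∀ m k c →
    sum (map (λ s → if ∣ s ∣ ≡ᵇ k then c else 0) (subsets m)) ≡ (m C k) * c
  sum-subsets-of-size zero    zero    c = refl
  sum-subsets-of-size zero    (suc k) c = refl
  sum-subsets-of-size (suc m) k       c = begin
    sum (map F (map (true ∷_) S ++ (map (false ∷_) S ++ [])))
      ≡⟨ cong (λ ys → sum (map F (map (true ∷_) S ++ ys))) (++-identityʳ _) ⟩
    sum (map F (map (true ∷_) S ++ map (false ∷_) S))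
      ≡⟨ cong sum (map-++ F (map (true ∷_) S) _) ⟩
    sum (map F (map (true ∷_) S) ++ map F (map (false ∷_) S))
      ≡⟨ sum-++ (map F (map (true ∷_) S)) _ ⟩
    sum (map F (map (true ∷_) S)) + sum (map F (map (false ∷_) S))
      ≡⟨ cong₂ _+_ (cong sum (map-∘ S)) (cong sum (map-∘ S)) ⟨
    sum (map (λ s → if suc ∣ s ∣ ≡ᵇ k then c else 0) S) + sum (map (λ s → if ∣ s ∣ ≡ᵇ k then c else 0) S)
      ≡⟨ split-first k ⟩
    (suc m C k) * c
      ∎
    where
    open ≡-Reasoning
    S : List (Subset m)
    S = subsets m
    F : Subset (suc m) → ℕ
    F s = if ∣ s ∣ ≡ᵇ k then c else 0
    split-first : ∀ k → sum (map (λ s → if suc ∣ s ∣ ≡ᵇ k then c else 0) S)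
                   + sum (map (λ s → if ∣ s ∣ ≡ᵇ k then c else 0) S) ≡ (suc m C k) * c
    split-first zero    = trans (cong (_+ sum (map (λ s → if ∣ s ∣ ≡ᵇ 0 then c else 0) S)) (sum-map-0 S))
                                (sum-subsets-of-size m zero c)
    split-first (suc k) = begin
      sum (map (λ s → if ∣ s ∣ ≡ᵇ k then c else 0) S) + sum (map (λ s → if ∣ s ∣ ≡ᵇ suc k then c else 0) S)
        ≡⟨ cong₂ _+_ (sum-subsets-of-size m k c) (sum-subsets-of-size m (suc k) c) ⟩
      (m C k) * c + (m C suc k) * c
        ≡⟨ ℕ.*-distribʳ-+ c (m C k) (m C suc k) ⟨
      (m C k + m C suc k) * c
        ≡⟨ cong (_* c) (nCk+nC[k+1]≡[n+1]C[k+1] m k) ⟩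
      (suc m C suc k) * c
        ∎

  swapAt : ℕ → Vec A m → Vec A m
  swapAt zero    (x ∷ y ∷ v) = y ∷ x ∷ v
  swapAt zero    (x ∷ [])    = x ∷ []
  swapAt _       []          = []
  swapAt (suc i) (x ∷ v)     = x ∷ swapAt i v

  swapAt-involutive : ∀ i (v : Vec A m) → swapAt i (swapAt i v) ≡ v
  swapAt-involutive zero    (x ∷ y ∷ v) = refl
  swapAt-involutive zero    (x ∷ [])    = refl
  swapAt-involutive zero    []          = refl
  swapAt-involutive (suc i) []          = refl
  swapAt-involutive (suc i) (x ∷ v)     = cong (x ∷_) (swapAt-involutive i v)

  initial : ∀ m → ℕ → Subset m
  initial zero    w       = []
  initial (suc m) zero    = false ∷ initial m zero
  initial (suc m) (suc w) = true ∷ initial m w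

  SwapInvariant : {B : Set} → (Vec A m → B) → Set
  SwapInvariant F = ∀ i v → F (swapAt i v) ≡ F v

  module _ {B : Set} where

    swapInvariant-∷ : (F : Vec A (suc m) → B) (x : A) → SwapInvariant F → SwapInvariant (λ v → F (x ∷ v))
    swapInvariant-∷ F x inv i v = inv (suc i) (x ∷ v)

    swapInvariant⇒depends-on-size : (F : Subset m → B) → SwapInvariant F → ∀ s → F s ≡ F (initial m ∣ s ∣)
    swapInvariant⇒depends-on-size F inv []          = refl
    swapInvariant⇒depends-on-size F inv (true ∷ s)  =
      swapInvariant⇒depends-on-size (λ v → F (true ∷ v)) (swapInvariant-∷ F true inv) s
    swapInvariant⇒depends-on-size F inv (false ∷ s) =
      trans (swapInvariant⇒depends-on-size (λ v → F (false ∷ v)) (swapInvariant-∷ F false inv) s)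
            (move-false-back _ ∣ s ∣ (∣p∣≤n s) F inv)
      where
      move-false-back : ∀ m w → w ≤ m → (F : Subset (suc m) → B) → SwapInvariant F →
        F (false ∷ initial m w) ≡ F (initial (suc m) w)
      move-false-back m       zero    _         F inv = refl
      move-false-back (suc m) (suc w) (s≤s w≤m) F inv =
        trans (inv 0 (true ∷ false ∷ initial m w))
              (move-false-back m w w≤m (λ v → F (true ∷ v)) (swapInvariant-∷ F true inv))

  -- The transposition of i and i + 1 (the identity if i + 1 ≥ m); swapAt i permutes entries by it.
  transposeAt : ℕ → Fin m → Fin m
  transposeAt {suc (suc m)} zero    zero          = suc zero
  transposeAt {suc (suc m)} zero    (suc zero)    = zero
  transposeAt {suc (suc m)} zero    (suc (suc u)) = suc (suc u)
  transposeAt {suc zero}    zero    u             = u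
  transposeAt               (suc i) zero          = zero
  transposeAt               (suc i) (suc u)       = suc (transposeAt i u)

  transposeAt-involutive : ∀ i (u : Fin m) → transposeAt i (transposeAt i u) ≡ u
  transposeAt-involutive {suc (suc m)} zero    zero          = refl
  transposeAt-involutive {suc (suc m)} zero    (suc zero)    = refl
  transposeAt-involutive {suc (suc m)} zero    (suc (suc u)) = refl
  transposeAt-involutive {suc zero}    zero    u             = refl
  transposeAt-involutive               (suc i) zero          = refl
  transposeAt-involutive               (suc i) (suc u)       = cong suc (transposeAt-involutive i u)

  transposeAt-preserves-<ᵇ : ∀ i (u v : Fin m) → transposeAt i u ≢ v →
    (toℕ (transposeAt i v) <ᵇ toℕ (transposeAt i u)) ≡ (toℕ v <ᵇ toℕ u)
  transposeAt-preserves-<ᵇ {suc (suc m)} zero zero          (suc zero) τu≢v = ⊥-elim (τu≢v refl)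
  transposeAt-preserves-<ᵇ {suc (suc m)} zero (suc zero)    zero       τu≢v = ⊥-elim (τu≢v refl)
  transposeAt-preserves-<ᵇ {suc (suc m)} zero zero          zero          _ = refl
  transposeAt-preserves-<ᵇ {suc (suc m)} zero zero          (suc (suc v)) _ = refl
  transposeAt-preserves-<ᵇ {suc (suc m)} zero (suc zero)    (suc zero)    _ = refl
  transposeAt-preserves-<ᵇ {suc (suc m)} zero (suc zero)    (suc (suc v)) _ = refl
  transposeAt-preserves-<ᵇ {suc (suc m)} zero (suc (suc u)) zero          _ = refl
  transposeAt-preserves-<ᵇ {suc (suc m)} zero (suc (suc u)) (suc zero)    _ = refl
  transposeAt-preserves-<ᵇ {suc (suc m)} zero (suc (suc u)) (suc (suc v)) _ = refl
  transposeAt-preserves-<ᵇ {suc zero}    zero u             v             _ = refl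
  transposeAt-preserves-<ᵇ (suc i) zero    zero    _ = refl
  transposeAt-preserves-<ᵇ (suc i) zero    (suc v) _ = refl
  transposeAt-preserves-<ᵇ (suc i) (suc u) zero    _ = refl
  transposeAt-preserves-<ᵇ (suc i) (suc u) (suc v) τu≢v =
    transposeAt-preserves-<ᵇ i u v (λ τu≡v → τu≢v (cong suc τu≡v))

  lookup-swapAt : ∀ i (v : Vec A m) u → lookup (swapAt i v) u ≡ lookup v (transposeAt i u)
  lookup-swapAt zero    (x ∷ y ∷ v) zero          = refl
  lookup-swapAt zero    (x ∷ y ∷ v) (suc zero)    = refl
  lookup-swapAt zero    (x ∷ y ∷ v) (suc (suc u)) = refl
  lookup-swapAt zero    (x ∷ [])    zero          = refl
  lookup-swapAt (suc i) (x ∷ v)     zero          = refl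
  lookup-swapAt (suc i) (x ∷ v)     (suc u)       = lookup-swapAt i v u

  swapAt-moves⇒lookup-≢ : ∀ i (v : Vec A m) → swapAt i v ≢ v → ∀ u → transposeAt i u ≢ u →
    lookup v (transposeAt i u) ≢ lookup v u
  swapAt-moves⇒lookup-≢ zero (x ∷ y ∷ v) moved zero       _ y≡x = moved (cong₂ (λ a b → a ∷ b ∷ v) y≡x (sym y≡x))
  swapAt-moves⇒lookup-≢ zero (x ∷ y ∷ v) moved (suc zero) _ x≡y = moved (cong₂ (λ a b → a ∷ b ∷ v) (sym x≡y) x≡y)
  swapAt-moves⇒lookup-≢ zero (x ∷ y ∷ v) _ (suc (suc u)) fixed = ⊥-elim (fixed refl)
  swapAt-moves⇒lookup-≢ zero (x ∷ [])    _ zero          fixed = ⊥-elim (fixed refl)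
  swapAt-moves⇒lookup-≢ (suc i) (x ∷ v)  _ zero          fixed = ⊥-elim (fixed refl)
  swapAt-moves⇒lookup-≢ (suc i) (x ∷ v) moved (suc u) moved-u =
    swapAt-moves⇒lookup-≢ i v (λ e → moved (cong (x ∷_) e)) u (λ e → moved-u (cong suc e))

  descents : List (Fin m) → List Bool
  descents []           = []
  descents (x ∷ [])     = []
  descents (x ∷ y ∷ ws) = (toℕ y <ᵇ toℕ x) ∷ descents (y ∷ ws)

  toList-descentSet : ∀ {l} (π : Vec (Fin m) l) → toList (descentSet π) ≡ descents (toList π)
  toList-descentSet []          = refl
  toList-descentSet (x ∷ [])    = refl
  toList-descentSet (x ∷ y ∷ π) = cong (_ ∷_) (toList-descentSet (y ∷ π))

  length-descents : ∀ (x : Fin m) xs → length (descents (x ∷ xs)) ≡ length xs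
  length-descents x []       = refl
  length-descents x (y ∷ xs) = cong suc (length-descents y xs)

  descents-++ : ∀ (x : Fin m) xs y ys →
    ∃[ b ] descents (x ∷ xs ++ y ∷ ys) ≡ descents (x ∷ xs) ++ b ∷ descents (y ∷ ys)
  descents-++ x []        y ys = _ , refl
  descents-++ x (x′ ∷ xs) y ys = let b , eq = descents-++ x′ xs y ys in b , cong (_ ∷_) eq

  clearAt : ℕ → List Bool → List Bool
  clearAt _       []      = []
  clearAt zero    (_ ∷ bs) = false ∷ bs
  clearAt (suc k) (b ∷ bs) = b ∷ clearAt k bs

  clearAt-junction : ∀ bs b cs → clearAt (length bs) (bs ++ b ∷ cs) ≡ bs ++ false ∷ cs
  clearAt-junction []       b cs = refl
  clearAt-junction (b′ ∷ bs) b cs = cong (b′ ∷_) (clearAt-junction bs b cs)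

  descents-agree-off-junction : ∀ (x x′ : Fin m) xs xs′ y y′ ys ys′ → length xs′ ≡ length xs →
    descents (x′ ∷ xs′) ≡ descents (x ∷ xs) → descents (y′ ∷ ys′) ≡ descents (y ∷ ys) →
    clearAt (length xs) (descents (x′ ∷ xs′ ++ y′ ∷ ys′)) ≡ clearAt (length xs) (descents (x ∷ xs ++ y ∷ ys))
  descents-agree-off-junction x x′ xs xs′ y y′ ys ys′ same-length first-block second-block
    with b′ , split′ ← descents-++ x′ xs′ y′ ys′ | b , split ← descents-++ x xs y ys = begin
    clearAt (length xs) (descents (x′ ∷ xs′ ++ y′ ∷ ys′))
      ≡⟨ cong (clearAt (length xs)) split′ ⟩
    clearAt (length xs) (descents (x′ ∷ xs′) ++ b′ ∷ descents (y′ ∷ ys′))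
      ≡⟨ cong (λ k → clearAt k (descents (x′ ∷ xs′) ++ b′ ∷ descents (y′ ∷ ys′)))
              (trans (sym same-length) (sym (length-descents x′ xs′))) ⟩
    clearAt (length (descents (x′ ∷ xs′))) (descents (x′ ∷ xs′) ++ b′ ∷ descents (y′ ∷ ys′))
      ≡⟨ clearAt-junction (descents (x′ ∷ xs′)) b′ _ ⟩
    descents (x′ ∷ xs′) ++ false ∷ descents (y′ ∷ ys′)
      ≡⟨ cong₂ (λ d e → d ++ false ∷ e) first-block second-block ⟩
    descents (x ∷ xs) ++ false ∷ descents (y ∷ ys)
      ≡⟨ clearAt-junction (descents (x ∷ xs)) b _ ⟨
    clearAt (length (descents (x ∷ xs))) (descents (x ∷ xs) ++ b ∷ descents (y ∷ ys))
      ≡⟨ cong (λ k → clearAt k (descents (x ∷ xs) ++ b ∷ descents (y ∷ ys))) (length-descents x xs) ⟩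
    clearAt (length xs) (descents (x ∷ xs) ++ b ∷ descents (y ∷ ys))
      ≡⟨ cong (clearAt (length xs)) split ⟨
    clearAt (length xs) (descents (x ∷ xs ++ y ∷ ys))
      ∎
    where open ≡-Reasoning

  flipAt : ℕ → Vec Bool m → Vec Bool m
  flipAt _       []      = []
  flipAt zero    (b ∷ v) = not b ∷ v
  flipAt (suc k) (b ∷ v) = b ∷ flipAt k v

  flipAt-involutive : ∀ k (v : Vec Bool m) → flipAt k (flipAt k v) ≡ v
  flipAt-involutive _       []      = refl
  flipAt-involutive zero    (b ∷ v) = cong (_∷ v) (Bool.not-involutive b)
  flipAt-involutive (suc k) (b ∷ v) = cong (b ∷_) (flipAt-involutive k v)

  flipAt-≢ : ∀ {k} → k < m → (v : Vec Bool m) → flipAt k v ≢ v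
  flipAt-≢ {k = zero}  _         (b ∷ v) eq = Bool.not-¬ refl (sym (Vec.∷-injectiveˡ eq))
  flipAt-≢ {k = suc k} (s≤s k<m) (b ∷ v) eq = flipAt-≢ k<m v (Vec.∷-injectiveʳ eq)

  clearAt-flipAt : ∀ k (v : Vec Bool m) → clearAt k (toList (flipAt k v)) ≡ clearAt k (toList v)
  clearAt-flipAt _       []      = refl
  clearAt-flipAt zero    (b ∷ v) = refl
  clearAt-flipAt (suc k) (b ∷ v) = cong (b ∷_) (clearAt-flipAt k v)

  clearAt-≡⇒≡⊎flipAt : ∀ k (d v : Vec Bool m) → clearAt k (toList d) ≡ clearAt k (toList v) →
    d ≡ v ⊎ d ≡ flipAt k v
  clearAt-≡⇒≡⊎flipAt _ [] [] _ = inj₁ refl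
  clearAt-≡⇒≡⊎flipAt zero (a ∷ d) (b ∷ v) eq
    with d≡v ← trans (sym (cast-is-id refl d)) (Vec.toList-injective refl d v (List.∷-injectiveʳ eq))
    with a Bool.≟ b
  ... | yes refl = inj₁ (cong (a ∷_) d≡v)
  ... | no a≢b   = inj₂ (cong₂ _∷_ (Bool.¬-not a≢b) d≡v)
  clearAt-≡⇒≡⊎flipAt (suc k) (a ∷ d) (b ∷ v) eq with refl ← List.∷-injectiveˡ eq
    with clearAt-≡⇒≡⊎flipAt k d v (List.∷-injectiveʳ eq)
  ... | inj₁ refl = inj₁ refl
  ... | inj₂ refl = inj₂ refl

  descents-map-transposeAt : ∀ i (zs : List (Fin m)) →
    (∀ {u v} → u ∈ zs → v ∈ zs → transposeAt i u ≡ v → u ≡ v) →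
    descents (map (transposeAt i) zs) ≡ descents zs
  descents-map-transposeAt i []           _        = refl
  descents-map-transposeAt i (x ∷ [])     _        = refl
  descents-map-transposeAt i (x ∷ y ∷ ws) no-pairs =
    cong₂ _∷_ (descent-preserved (transposeAt i x Fin.≟ y))
              (descents-map-transposeAt i (y ∷ ws) λ u∈ v∈ → no-pairs (there u∈) (there v∈))
    where
    descent-preserved : Dec (transposeAt i x ≡ y) →
      (toℕ (transposeAt i y) <ᵇ toℕ (transposeAt i x)) ≡ (toℕ y <ᵇ toℕ x)
    descent-preserved (no τx≢y) = transposeAt-preserves-<ᵇ i x y τx≢y
    descent-preserved (yes τx≡y) with refl ← no-pairs (here refl) (there (here refl)) τx≡y =
      cong (λ z → toℕ z <ᵇ toℕ z) τx≡y

  ∣tabulate-any?∣ : ∀ {xs : List (Fin m)} → Unique xs → ∣ tabulate (λ v → does (any? (v Fin.≟_) xs)) ∣ ≡ length xs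
  ∣tabulate-any?∣ {m} {xs} u = trans (∣tabulate∣ (λ v → v) (λ v → does (any? (v Fin.≟_) xs)))
    (length-≡-if-same-elements (Unique.filter⁺ _ {allFin m} (Unique.allFin⁺ m)) u (mk⇔ to from))
    where
    ∣tabulate∣ : ∀ {l} (g : Fin l → Fin m) (f : Fin m → Bool) →
      ∣ tabulate (λ v → f (g v)) ∣ ≡ length (filter (λ v → f v Bool.≟ true) (Data.List.tabulate g))
    ∣tabulate∣ {zero}  g f = refl
    ∣tabulate∣ {suc l} g f with f (g zero)
    ... | true  = cong suc (∣tabulate∣ (λ v → g (suc v)) f)
    ... | false = ∣tabulate∣ (λ v → g (suc v)) f
    to : ∀ {v} → v ∈ filter (λ v → does (any? (v Fin.≟_) xs) Bool.≟ true) (allFin m) → v ∈ xs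
    to {v} v∈ with any? (v Fin.≟_) xs | proj₂ (∈-filter⁻ (λ v → does (any? (v Fin.≟_) xs) Bool.≟ true) {xs = allFin m} v∈)
    ... | yes v∈xs | _  = v∈xs
    ... | no _     | ()
    from : ∀ {v} → v ∈ xs → v ∈ filter (λ v → does (any? (v Fin.≟_) xs) Bool.≟ true) (allFin m)
    from {v} v∈ with any? (v Fin.≟_) xs
    ... | yes _  = ∈-filter⁺ (λ v → does (any? (v Fin.≟_) xs) Bool.≟ true) (∈-allFin v) (dec-true (any? (v Fin.≟_) xs) v∈)
    ... | no v∉ = ⊥-elim (v∉ v∈)

  transposeAt-within-colour-class : ∀ i (colour : Fin m → Bool) →
    (∀ u → transposeAt i u ≢ u → colour (transposeAt i u) ≢ colour u) →
    ∀ c {zs : List (Fin m)} → (∀ {z} → z ∈ zs → colour z ≡ c) →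
    ∀ {u v} → u ∈ zs → v ∈ zs → transposeAt i u ≡ v → u ≡ v
  transposeAt-within-colour-class i colour recolours c same-colour {u = u} u∈ v∈ τu≡v
    with transposeAt i u Fin.≟ u
  ... | yes τu≡u = trans (sym τu≡u) τu≡v
  ... | no moved = ⊥-elim (recolours u moved
                     (trans (same-colour (subst (_∈ _) (sym τu≡v) v∈)) (sym (same-colour u∈))))

  -- The pairing β(S) + β(S′) = C(n,j)·X

  module _ (n j : ℕ) (1≤j : 1 ≤ j) (j<n : j < n) where

    private
      -- Entry k of S : SubsetOf[n-1] n stands for k + 1, so j sits at entry j ∸ 1.
      junction : ℕ
      junction = j ∸ 1

      perms : List (Vec (Fin n) n)
      perms = allVecs (allFin n) n

      firstBlock : Vec (Fin n) n → List (Fin n)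
      firstBlock π = take j (toList π)

      inFirstBlock : Vec (Fin n) n → Fin n → Bool
      inFirstBlock π v = does (any? (v Fin.≟_) (firstBlock π))

      blockSet : Vec (Fin n) n → Subset n
      blockSet π = tabulate (inFirstBlock π)

      AgreesOffJunction : SubsetOf[n-1] n → Vec (Fin n) n → Set
      AgreesOffJunction S π = clearAt junction (toList (descentSet π)) ≡ clearAt junction (toList S)

      Admissible : SubsetOf[n-1] n → Vec (Fin n) n → Set
      Admissible S π = IsPerm π × AgreesOffJunction S π

      admissible? : ∀ S → Decidable (Admissible S)
      admissible? S π = isPerm? π ×-dec List.≡-dec Bool._≟_ _ _

      fibre : SubsetOf[n-1] n → Subset n → ℕ
      fibre S b = length (filter (λ π → admissible? S π ×-dec Vec.≡-dec Bool._≟_ (blockSet π) b) perms)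

      length-firstBlock : ∀ π → length (firstBlock π) ≡ j
      length-firstBlock π = trans (List.length-take j (toList π))
        (trans (cong (j ℕ.⊓_) (Vec.length-toList π)) (ℕ.m≤n⇒m⊓n≡m (ℕ.<⇒≤ j<n)))

      ∣blockSet∣ : ∀ π → IsPerm π → ∣ blockSet π ∣ ≡ j
      ∣blockSet∣ π perm = trans (∣tabulate-any?∣ (Unique.take⁺ j perm)) (length-firstBlock π)

      module Relabel (i : ℕ) where

        τ : Fin n → Fin n
        τ = transposeAt i

        relabel : Vec (Fin n) n → Vec (Fin n) n
        relabel = Vec.map τ

        relabel-involutive : ∀ π → relabel (relabel π) ≡ π
        relabel-involutive π = trans (sym (Vec.map-∘ τ τ π))
          (trans (Vec.map-cong (transposeAt-involutive i) π) (Vec.map-id π))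

        τ-injective : ∀ {u v} → τ u ≡ τ v → u ≡ v
        τ-injective {u} {v} τu≡τv =
          trans (sym (transposeAt-involutive i u)) (trans (cong τ τu≡τv) (transposeAt-involutive i v))

        relabel-perm : ∀ π → IsPerm π → IsPerm (relabel π)
        relabel-perm π perm = subst Unique (sym (Vec.toList-map τ π)) (Unique.map⁺ τ-injective perm)

        firstBlock-relabel : ∀ π → firstBlock (relabel π) ≡ map τ (firstBlock π)
        firstBlock-relabel π = trans (cong (take j) (Vec.toList-map τ π)) (List.take-map j (toList π))

        inFirstBlock-relabel : ∀ π v → inFirstBlock (relabel π) v ≡ inFirstBlock π (τ v)
        inFirstBlock-relabel π v = trans (cong (λ zs → does (any? (v Fin.≟_) zs)) (firstBlock-relabel π))
          (does-⇔ (mk⇔ to from) (any? (v Fin.≟_) _) (any? (τ v Fin.≟_) _))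
          where
          to : v ∈ map τ (firstBlock π) → τ v ∈ firstBlock π
          to v∈ with u , u∈ , refl ← ∈-map⁻ τ v∈ = subst (_∈ _) (sym (transposeAt-involutive i u)) u∈
          from : τ v ∈ firstBlock π → v ∈ map τ (firstBlock π)
          from τv∈ = subst (_∈ _) (transposeAt-involutive i v) (∈-map⁺ τ τv∈)

        blockSet-relabel : ∀ π → blockSet (relabel π) ≡ swapAt i (blockSet π)
        blockSet-relabel π = trans
          (Vec.tabulate-cong λ v → begin
            inFirstBlock (relabel π) v          ≡⟨ inFirstBlock-relabel π v ⟩
            inFirstBlock π (τ v)                ≡⟨ Vec.lookup∘tabulate (inFirstBlock π) (τ v) ⟨
            lookup (blockSet π) (τ v)           ≡⟨ lookup-swapAt i (blockSet π) v ⟨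
            lookup (swapAt i (blockSet π)) v    ∎)
          (Vec.tabulate∘lookup (swapAt i (blockSet π)))
          where open ≡-Reasoning

        separates : ∀ π → swapAt i (blockSet π) ≢ blockSet π →
          ∀ u → τ u ≢ u → inFirstBlock π (τ u) ≢ inFirstBlock π u
        separates π moved u τu≢u same = swapAt-moves⇒lookup-≢ i (blockSet π) moved u τu≢u
          (trans (Vec.lookup∘tabulate _ (τ u)) (trans same (sym (Vec.lookup∘tabulate _ u))))

        NoPairsIn : List (Fin n) → Set
        NoPairsIn zs = ∀ {u v} → u ∈ zs → v ∈ zs → τ u ≡ v → u ≡ v

        relabel-agrees-off-junction : ∀ zs ws → length zs ≡ j → 1 ≤ length ws → NoPairsIn zs → NoPairsIn ws →
          clearAt junction (descents (map τ (zs ++ ws))) ≡ clearAt junction (descents (zs ++ ws))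
        relabel-agrees-off-junction []       _        len _  _ _ = ⊥-elim (ℕ.<⇒≢ 1≤j len)
        relabel-agrees-off-junction (x ∷ xs) (y ∷ ys) len _ no-pairs₁ no-pairs₂ =
          subst (λ k → clearAt k (descents (map τ (x ∷ xs ++ y ∷ ys))) ≡ clearAt k (descents (x ∷ xs ++ y ∷ ys)))
            (cong pred len)
            (trans (cong (λ zs → clearAt (length xs) (descents (τ x ∷ zs))) (List.map-++ τ xs (y ∷ ys)))
              (descents-agree-off-junction x (τ x) xs (map τ xs) y (τ y) ys (map τ ys) (length-map τ xs)
                (descents-map-transposeAt i (x ∷ xs) no-pairs₁) (descents-map-transposeAt i (y ∷ ys) no-pairs₂)))

        -- τ only exchanges values lying in different blocks, so the relative order inside each
        -- block, and with it every descent away from the junction, is preserved.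
        relabel-agrees : ∀ S π → IsPerm π → swapAt i (blockSet π) ≢ blockSet π →
          AgreesOffJunction S π → AgreesOffJunction S (relabel π)
        relabel-agrees S π perm moved agrees = begin
          clearAt junction (toList (descentSet (relabel π)))
            ≡⟨ cong (clearAt junction) (toList-descentSet (relabel π)) ⟩
          clearAt junction (descents (toList (relabel π)))
            ≡⟨ cong (λ zs → clearAt junction (descents zs)) (trans (Vec.toList-map τ π) (cong (map τ) (sym split))) ⟩
          clearAt junction (descents (map τ (firstBlock π ++ rest)))
            ≡⟨ relabel-agrees-off-junction (firstBlock π) rest (length-firstBlock π) 1≤∣rest∣ no-pairs₁ no-pairs₂ ⟩
          clearAt junction (descents (firstBlock π ++ rest))
            ≡⟨ cong (λ zs → clearAt junction (descents zs)) split ⟩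
          clearAt junction (descents (toList π))
            ≡⟨ cong (clearAt junction) (toList-descentSet π) ⟨
          clearAt junction (toList (descentSet π))
            ≡⟨ agrees ⟩
          clearAt junction (toList S)
            ∎
          where
          open ≡-Reasoning
          rest : List (Fin n)
          rest = drop j (toList π)
          split : firstBlock π ++ rest ≡ toList π
          split = List.take++drop≡id j (toList π)
          1≤∣rest∣ : 1 ≤ length rest
          1≤∣rest∣ = subst (1 ≤_) (sym (trans (List.length-drop j (toList π)) (cong (_∸ j) (Vec.length-toList π))))
            (ℕ.m<n⇒0<n∸m j<n)
          no-pairs₁ : NoPairsIn (firstBlock π)
          no-pairs₁ = transposeAt-within-colour-class i (inFirstBlock π) (separates π moved) true
            λ z∈ → dec-true (any? _ _) z∈
          no-pairs₂ : NoPairsIn rest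
          no-pairs₂ = transposeAt-within-colour-class i (inFirstBlock π) (separates π moved) false
            λ z∈ → dec-false (any? _ _) λ z∈₁ → unique-++⇒disjoint (subst Unique (sym split) perm) z∈₁ z∈

        InFibre : SubsetOf[n-1] n → Subset n → Vec (Fin n) n → Set
        InFibre S b π = Admissible S π × blockSet π ≡ b

        relabel-fibre : ∀ S b π → swapAt i b ≢ b → InFibre S b π → InFibre S (swapAt i b) (relabel π)
        relabel-fibre S b π moved ((perm , agrees) , refl) =
          (relabel-perm π perm , relabel-agrees S π perm moved agrees) , blockSet-relabel π

        fibre-swapAt : ∀ S b → fibre S (swapAt i b) ≡ fibre S b
        fibre-swapAt S b with Vec.≡-dec Bool._≟_ (swapAt i b) b
        ... | yes fixed = cong (fibre S) fixed
        ... | no moved  = sym (length-filter-involution (allVecs-enumerates (allFin-enumerates n) n)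
            relabel relabel-involutive _ _
            (λ π → relabel-fibre S b π moved)
            (λ π in-fibre → subst (λ b′ → InFibre S b′ (relabel π)) (swapAt-involutive i b)
               (relabel-fibre S (swapAt i b) π (λ fixed → moved (trans (sym fixed) (swapAt-involutive i b))) in-fibre)))

    private
      fibre-by-size : ∀ S b → fibre S b ≡ (if ∣ b ∣ ≡ᵇ j then fibre S (initial n j) else 0)
      fibre-by-size S b with ∣ b ∣ ≡ᵇ j in size
      ... | true  = trans (swapInvariant⇒depends-on-size (fibre S) (λ i → Relabel.fibre-swapAt i S) b)
                          (cong (λ w → fibre S (initial n w)) (ℕ.≡ᵇ⇒≡ ∣ b ∣ j (subst T (sym size) tt)))
      ... | false = cong length (List.filter-none _ (All.universal wrong-size perms))
        where
        wrong-size : ∀ π → ¬ (Admissible S π × blockSet π ≡ b)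
        wrong-size π ((perm , _) , refl) = subst T size (ℕ.≡⇒≡ᵇ ∣ blockSet π ∣ j (∣blockSet∣ π perm))

      admissible-count : ∀ S → length (filter (admissible? S) perms) ≡ (n C j) * fibre S (initial n j)
      admissible-count S = begin
        length (filter (admissible? S) perms)
          ≡⟨ length-filter-fibres (Vec.≡-dec Bool._≟_) (allVecs-enumerates Bool-enumerates n)
                                  blockSet (admissible? S) perms ⟩
        sum (map (fibre S) (subsets n))
          ≡⟨ cong sum (map-cong (fibre-by-size S) (subsets n)) ⟩
        sum (map (λ b → if ∣ b ∣ ≡ᵇ j then fibre S (initial n j) else 0) (subsets n))
          ≡⟨ sum-subsets-of-size n j (fibre S (initial n j)) ⟩
        (n C j) * fibre S (initial n j)
          ∎
        where open ≡-Reasoning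

      junction<n-1 : junction < pred n
      junction<n-1 = ℕ.∸-monoˡ-< j<n 1≤j

      β+β-flipAt≡admissible : ∀ S → β n S + β n (flipAt junction S) ≡ length (filter (admissible? S) perms)
      β+β-flipAt≡admissible S = length-filter-⊎ (descentSet-≡? S) (descentSet-≡? (flipAt junction S)) (admissible? S)
        split join disjoint perms
        where
        descentSet-≡? : ∀ S′ → Decidable (λ π → IsPerm π × descentSet π ≡ S′)
        descentSet-≡? S′ π = isPerm? π ×-dec Vec.≡-dec Bool._≟_ (descentSet π) S′
        split : ∀ π → Admissible S π → (IsPerm π × descentSet π ≡ S) ⊎ (IsPerm π × descentSet π ≡ flipAt junction S)
        split π (perm , agrees) with clearAt-≡⇒≡⊎flipAt junction (descentSet π) S agrees
        ... | inj₁ eq = inj₁ (perm , eq)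
        ... | inj₂ eq = inj₂ (perm , eq)
        join : ∀ π → (IsPerm π × descentSet π ≡ S) ⊎ (IsPerm π × descentSet π ≡ flipAt junction S) → Admissible S π
        join π (inj₁ (perm , eq)) = perm , cong (λ d → clearAt junction (toList d)) eq
        join π (inj₂ (perm , flipped)) = perm , trans (cong (λ d → clearAt junction (toList d)) flipped)
                                                      (clearAt-flipAt junction S)
        disjoint : ∀ π → IsPerm π × descentSet π ≡ S → ¬ (IsPerm π × descentSet π ≡ flipAt junction S)
        disjoint π (_ , eq) (_ , flipped) = flipAt-≢ junction<n-1 S (trans (sym flipped) eq)

    β+β-flipAt : ∀ S → ∃[ X ] β n S + β n (flipAt (j ∸ 1) S) ≡ (n C j) * X
    β+β-flipAt S = fibre S (initial n j) , trans (β+β-flipAt≡admissible S) (admissible-count S)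

  -- Divisibility of binomial coefficients

  C-absorption : ∀ m k → suc k * (suc m C suc k) ≡ suc m * (m C k)
  C-absorption zero    zero    = refl
  C-absorption zero    (suc k) = ℕ.*-zeroʳ (suc (suc k))
  C-absorption (suc m) zero    = trans (ℕ.*-identityˡ _) (trans (nC1≡n (suc (suc m))) (sym (ℕ.*-identityʳ _)))
  C-absorption (suc m) (suc k) = begin
    suc (suc k) * (suc (suc m) C suc (suc k))   ≡⟨ cong (suc (suc k) *_) (nCk+nC[k+1]≡[n+1]C[k+1] (suc m) (suc k)) ⟨
    suc (suc k) * (c₁ + c₂)                     ≡⟨ distribute (suc k) c₁ c₂ ⟩
    suc k * c₁ + c₁ + suc (suc k) * c₂          ≡⟨ cong₂ (λ x y → x + c₁ + y) (C-absorption m k) (C-absorption m (suc k)) ⟩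
    suc m * (m C k) + c₁ + suc m * (m C suc k)  ≡⟨ collect (suc m) (m C k) c₁ (m C suc k) ⟩
    suc m * (m C k + m C suc k) + c₁            ≡⟨ cong (λ x → suc m * x + c₁) (nCk+nC[k+1]≡[n+1]C[k+1] m k) ⟩
    suc m * c₁ + c₁                             ≡⟨ ℕ.+-comm (suc m * c₁) c₁ ⟩
    suc (suc m) * c₁                            ∎
    where
    open ≡-Reasoning
    c₁ c₂ : ℕ
    c₁ = suc m C suc k
    c₂ = suc m C suc (suc k)
    distribute : ∀ x a b → suc x * (a + b) ≡ x * a + a + suc x * b
    distribute = solve-∀
    collect : ∀ y c a d → y * c + a + y * d ≡ y * (c + d) + a
    collect = solve-∀

  module _ {p : ℕ} (p-prime : Prime p) where

    prime-power-∣-cancelʳ : ∀ t a c → ¬ (p ∣ c) → p ^ t ∣ a * c → p ^ t ∣ a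
    prime-power-∣-cancelʳ zero    a c _   _ = 1∣ a
    prime-power-∣-cancelʳ (suc t) a c p∤c pᵗ⁺¹∣ac with euclidsLemma a c p-prime (∣-trans (m∣m*n (p ^ t)) pᵗ⁺¹∣ac)
    ... | inj₂ p∣c = ⊥-elim (p∤c p∣c)
    ... | inj₁ (divides a′ refl) = subst (p ^ suc t ∣_) (ℕ.*-comm p a′)
      (*-monoʳ-∣ p (prime-power-∣-cancelʳ t a′ c p∤c
        (*-cancelˡ-∣ p {{prime⇒nonZero p-prime}} (subst (p * p ^ t ∣_) (reassociate a′ p c) pᵗ⁺¹∣ac))))
      where
      reassociate : ∀ a p c → a * p * c ≡ p * (a * c)
      reassociate = solve-∀

    prime∣C : ∀ t n j → p ^ t ∣ n → 1 ≤ j → ¬ (p ^ t ∣ j) → p ∣ n C j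
    prime∣C t zero    (suc k) _    _ _    = divides 0 refl
    prime∣C t (suc m) (suc k) pᵗ∣n _ pᵗ∤j with p ∣? (suc m C suc k)
    ... | yes p∣C = p∣C
    ... | no  p∤C = ⊥-elim (pᵗ∤j (prime-power-∣-cancelʳ t (suc k) (suc m C suc k) p∤C
            (subst (p ^ t ∣_) (sym (C-absorption m k)) (∣m⇒∣m*n (m C k) pᵗ∣n))))

  -- Lucas' theorem modulo 2

  pascal² : ∀ m k → suc (suc m) C suc (suc k) ≡ m C k + m C suc k + (m C suc k + m C suc (suc k))
  pascal² m k = trans (sym (nCk+nC[k+1]≡[n+1]C[k+1] (suc m) (suc k)))
    (cong₂ _+_ (sym (nCk+nC[k+1]≡[n+1]C[k+1] m k)) (sym (nCk+nC[k+1]≡[n+1]C[k+1] m (suc k))))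

  parity-x+y+y+z : ∀ x y z → parity (x + y + (y + z)) ≡ parity x ℙ.+ parity z
  parity-x+y+y+z x y z rewrite +-homo-+ (x + y) (y + z) | +-homo-+ x y | +-homo-+ y z
    with parity x | parity y | parity z
  ... | 0ℙ | 0ℙ | _  = refl
  ... | 0ℙ | 1ℙ | 0ℙ = refl
  ... | 0ℙ | 1ℙ | 1ℙ = refl
  ... | 1ℙ | 0ℙ | _  = refl
  ... | 1ℙ | 1ℙ | 0ℙ = refl
  ... | 1ℙ | 1ℙ | 1ℙ = refl

  -- Unlike 2 * a, this reduces to suc (suc (double a)) at suc a, matching pascal².
  double : ℕ → ℕ
  double zero    = zero
  double (suc a) = suc (suc (double a))

  data Halving : ℕ → Set where
    even : ∀ a → Halving (double a)
    odd  : ∀ a → Halving (suc (double a))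

  halving : ∀ m → Halving m
  halving zero          = even zero
  halving (suc zero)    = odd zero
  halving (suc (suc m)) with halving m
  ... | even a = even (suc a)
  ... | odd a  = odd (suc a)

  ⌊double/2⌋ : ∀ a → ⌊ double a /2⌋ ≡ a
  ⌊double/2⌋ zero    = refl
  ⌊double/2⌋ (suc a) = cong suc (⌊double/2⌋ a)

  ⌊1+double/2⌋ : ∀ a → ⌊ suc (double a) /2⌋ ≡ a
  ⌊1+double/2⌋ zero    = refl
  ⌊1+double/2⌋ (suc a) = cong suc (⌊1+double/2⌋ a)

  parity-double : ∀ a → parity (double a) ≡ 0ℙ
  parity-double zero    = refl
  parity-double (suc a) = parity-double a

  parity-1+double : ∀ a → parity (suc (double a)) ≡ 1ℙ
  parity-1+double zero    = refl
  parity-1+double (suc a) = parity-1+double a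

  parity-C-even-odd : ∀ a b → parity (double a C suc (double b)) ≡ 0ℙ
  parity-C-even-odd zero    b       = refl
  parity-C-even-odd (suc a) zero    = trans (cong parity (nC1≡n (double (suc a)))) (parity-double (suc a))
  parity-C-even-odd (suc a) (suc b) = begin
    parity (double (suc a) C suc (double (suc b)))
      ≡⟨ cong parity (pascal² (double a) (suc (double b))) ⟩
    parity (double a C suc (double b) + _ + (_ + double a C suc (double (suc b))))
      ≡⟨ parity-x+y+y+z (double a C suc (double b)) _ _ ⟩
    parity (double a C suc (double b)) ℙ.+ parity (double a C suc (double (suc b)))
      ≡⟨ cong₂ ℙ._+_ (parity-C-even-odd a b) (parity-C-even-odd a (suc b)) ⟩
    0ℙ
      ∎
    where open ≡-Reasoning

  parity-C-even-even : ∀ a b → parity (double a C double b) ≡ parity (a C b)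
  parity-C-even-even zero    zero    = refl
  parity-C-even-even zero    (suc b) = refl
  parity-C-even-even (suc a) zero    = refl
  parity-C-even-even (suc a) (suc b) = begin
    parity (double (suc a) C double (suc b))
      ≡⟨ cong parity (pascal² (double a) (double b)) ⟩
    parity (double a C double b + _ + (_ + double a C double (suc b)))
      ≡⟨ parity-x+y+y+z (double a C double b) _ _ ⟩
    parity (double a C double b) ℙ.+ parity (double a C double (suc b))
      ≡⟨ cong₂ ℙ._+_ (parity-C-even-even a b) (parity-C-even-even a (suc b)) ⟩
    parity (a C b) ℙ.+ parity (a C suc b)
      ≡⟨ +-homo-+ (a C b) (a C suc b) ⟨
    parity (a C b + a C suc b)
      ≡⟨ cong parity (nCk+nC[k+1]≡[n+1]C[k+1] a b) ⟩
    parity (suc a C suc b)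
      ∎
    where open ≡-Reasoning

  parity-C-odd-even : ∀ a b → parity (suc (double a) C double b) ≡ parity (a C b)
  parity-C-odd-even a zero    = refl
  parity-C-odd-even a (suc b) = begin
    parity (suc (double a) C suc (suc (double b)))
      ≡⟨ cong parity (nCk+nC[k+1]≡[n+1]C[k+1] (double a) (suc (double b))) ⟨
    parity (double a C suc (double b) + double a C double (suc b))
      ≡⟨ +-homo-+ (double a C suc (double b)) _ ⟩
    parity (double a C suc (double b)) ℙ.+ parity (double a C double (suc b))
      ≡⟨ cong₂ ℙ._+_ (parity-C-even-odd a b) (parity-C-even-even a (suc b)) ⟩
    parity (a C suc b)
      ∎
    where open ≡-Reasoning

  parity-C-odd-odd : ∀ a b → parity (suc (double a) C suc (double b)) ≡ parity (a C b)
  parity-C-odd-odd a b = begin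
    parity (suc (double a) C suc (double b))
      ≡⟨ cong parity (nCk+nC[k+1]≡[n+1]C[k+1] (double a) (double b)) ⟨
    parity (double a C double b + double a C suc (double b))
      ≡⟨ +-homo-+ (double a C double b) _ ⟩
    parity (double a C double b) ℙ.+ parity (double a C suc (double b))
      ≡⟨ cong₂ ℙ._+_ (parity-C-even-even a b) (parity-C-even-odd a b) ⟩
    parity (a C b) ℙ.+ 0ℙ
      ≡⟨ ℙ+-identityʳ (parity (a C b)) ⟩
    parity (a C b)
      ∎
    where open ≡-Reasoning

  C-odd⇒halves-C-odd : ∀ m k → parity (m C k) ≡ 1ℙ →
    parity (⌊ m /2⌋ C ⌊ k /2⌋) ≡ 1ℙ × (parity k ≡ 1ℙ → parity m ≡ 1ℙ)
  C-odd⇒halves-C-odd m k odd-C with halving m | halving k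
  ... | even a | even b rewrite ⌊double/2⌋ a | ⌊double/2⌋ b =
    trans (sym (parity-C-even-even a b)) odd-C , λ odd-k → ⊥-elim (p≢p⁻¹ 0ℙ (trans (sym (parity-double b)) odd-k))
  ... | even a | odd b = ⊥-elim (p≢p⁻¹ 0ℙ (trans (sym (parity-C-even-odd a b)) odd-C))
  ... | odd a  | even b rewrite ⌊1+double/2⌋ a | ⌊double/2⌋ b =
    trans (sym (parity-C-odd-even a b)) odd-C , λ _ → parity-1+double a
  ... | odd a  | odd b rewrite ⌊1+double/2⌋ a | ⌊1+double/2⌋ b =
    trans (sym (parity-C-odd-odd a b)) odd-C , λ _ → parity-1+double a

  /2≡⌊/2⌋ : ∀ x → x / 2 ≡ ⌊ x /2⌋
  /2≡⌊/2⌋ zero          = refl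
  /2≡⌊/2⌋ (suc zero)    = refl
  /2≡⌊/2⌋ (suc (suc x)) = trans (m/n≡1+[m∸n]/n {suc (suc x)} {2} (s≤s (s≤s z≤n))) (cong suc (/2≡⌊/2⌋ x))

  bit : ℕ → ℕ → ℕ
  bit i x = (x / 2 ^ i) {{ℕ.m^n≢0 2 i}} % 2

  bit-zero : ∀ x → bit 0 x ≡ x % 2
  bit-zero x = cong (_% 2) (n/1≡n x)

  bit-suc : ∀ i x → bit (suc i) x ≡ bit i ⌊ x /2⌋
  bit-suc i x = cong (_% 2) (trans (sym (m/n/o≡m/[n*o] x 2 (2 ^ i) {{_}} {{ℕ.m^n≢0 2 i}} {{ℕ.m^n≢0 2 (suc i)}}))
                                   (cong (λ y → (y / 2 ^ i) {{ℕ.m^n≢0 2 i}}) (/2≡⌊/2⌋ x)))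

  %2≡1⇔parity≡1ℙ : ∀ x → x % 2 ≡ 1 ⇔ parity x ≡ 1ℙ
  %2≡1⇔parity≡1ℙ zero          = mk⇔ (λ ()) (λ ())
  %2≡1⇔parity≡1ℙ (suc zero)    = mk⇔ (λ _ → refl) (λ _ → refl)
  %2≡1⇔parity≡1ℙ (suc (suc x)) = %2≡1⇔parity≡1ℙ x

  C-odd⇒bits-⊆ : ∀ i m k → parity (m C k) ≡ 1ℙ → bit i k ≡ 1 → bit i m ≡ 1
  C-odd⇒bits-⊆ zero    m k odd-C bit-k = trans (bit-zero m)
    (Equivalence.from (%2≡1⇔parity≡1ℙ m) (proj₂ (C-odd⇒halves-C-odd m k odd-C)
      (Equivalence.to (%2≡1⇔parity≡1ℙ k) (trans (sym (bit-zero k)) bit-k))))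
  C-odd⇒bits-⊆ (suc i) m k odd-C bit-k = trans (bit-suc i m)
    (C-odd⇒bits-⊆ i ⌊ m /2⌋ ⌊ k /2⌋ (proj₁ (C-odd⇒halves-C-odd m k odd-C)) (trans (sym (bit-suc i k)) bit-k))

  -- Binary digits and essential elements

  bitValue : ℕ → ℕ → ℕ
  bitValue i x = if does (bit i x ℕ.≟ 1) then 2 ^ i else 0

  bitValue-zero : ∀ x → bitValue 0 x ≡ x % 2
  bitValue-zero x rewrite bit-zero x = digit (x % 2) (m%n<n x 2)
    where
    digit : ∀ d → d < 2 → (if does (d ℕ.≟ 1) then 1 else 0) ≡ d
    digit zero       _ = refl
    digit (suc zero) _ = refl
    digit (suc (suc d)) (s≤s (s≤s ()))

  bitValue-suc : ∀ i x → bitValue (suc i) x ≡ 2 * bitValue i ⌊ x /2⌋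
  bitValue-suc i x rewrite bit-suc i x with does (bit i ⌊ x /2⌋ ℕ.≟ 1)
  ... | true  = refl
  ... | false = refl

  map-applyUpTo : ∀ (g : ℕ → A) f N → map g (applyUpTo f N) ≡ applyUpTo (λ i → g (f i)) N
  map-applyUpTo g f zero    = refl
  map-applyUpTo g f (suc N) = cong (g (f 0) ∷_) (map-applyUpTo g (λ i → f (suc i)) N)

  sum-applyUpTo-2* : ∀ F G N → (∀ i → F i ≡ 2 * G i) → sum (applyUpTo F N) ≡ 2 * sum (applyUpTo G N)
  sum-applyUpTo-2* F G zero    _   = refl
  sum-applyUpTo-2* F G (suc N) F≡2G = trans (cong₂ _+_ (F≡2G 0) (sum-applyUpTo-2* _ _ N λ i → F≡2G (suc i)))
    (sym (ℕ.*-distribˡ-+ 2 (G 0) _))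

  binary-expansion : ∀ N x → x < 2 ^ N → sum (map (λ i → bitValue i x) (upTo N)) ≡ x
  binary-expansion N x x<2ᴺ = trans (cong sum (map-applyUpTo _ (λ i → i) N)) (expansion N x x<2ᴺ)
    where
    expansion : ∀ N x → x < 2 ^ N → sum (applyUpTo (λ i → bitValue i x) N) ≡ x
    expansion zero    zero    _ = refl
    expansion zero    (suc x) (s≤s ())
    expansion (suc N) x x<2ᴺ⁺¹ = begin
      bitValue 0 x + sum (applyUpTo (λ i → bitValue (suc i) x) N)
        ≡⟨ cong₂ _+_ (bitValue-zero x) (sum-applyUpTo-2* _ _ N (λ i → bitValue-suc i x)) ⟩
      x % 2 + 2 * sum (applyUpTo (λ i → bitValue i ⌊ x /2⌋) N)
        ≡⟨ cong (λ y → x % 2 + 2 * y) (expansion N ⌊ x /2⌋ ⌊x/2⌋<2ᴺ) ⟩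
      x % 2 + 2 * ⌊ x /2⌋
        ≡⟨ cong (λ y → x % 2 + y) (trans (ℕ.*-comm 2 ⌊ x /2⌋) (cong (_* 2) (sym (/2≡⌊/2⌋ x)))) ⟩
      x % 2 + x / 2 * 2
        ≡⟨ m≡m%n+[m/n]*n x 2 ⟨
      x ∎
      where
      open ≡-Reasoning
      ⌊x/2⌋<2ᴺ : ⌊ x /2⌋ < 2 ^ N
      ⌊x/2⌋<2ᴺ = subst (_< 2 ^ N) (/2≡⌊/2⌋ x) (m<n*o⇒m/o<n (subst (x <_) (ℕ.*-comm 2 (2 ^ N)) x<2ᴺ⁺¹))

  n<2^n : ∀ n → n < 2 ^ n
  n<2^n zero    = s≤s z≤n
  n<2^n (suc n) = ℕ.+-mono-≤ (ℕ.m^n>0 2 n) (subst (suc n ≤_) (sym (ℕ.+-identityʳ _)) (n<2^n n))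

  selectBits : ℕ → (js : List ℕ) → Vec Bool (length js)
  selectBits x []       = []
  selectBits x (i ∷ js) = does (bit i x ℕ.≟ 1) ∷ selectBits x js

  selectedSum-selectBits : ∀ x js → selectedSum js (selectBits x js) ≡ sum (map (λ i → bitValue i x) js)
  selectedSum-selectBits x []       = refl
  selectedSum-selectBits x (i ∷ js) = cong (bitValue i x +_) (selectedSum-selectBits x js)

  selectedSum-none : ∀ js → selectedSum js (replicate (length js) false) ≡ 0
  selectedSum-none []       = refl
  selectedSum-none (i ∷ js) = selectedSum-none js

  selectedSum-all : ∀ js → selectedSum js (replicate (length js) true) ≡ sum (map (2 ^_) js)
  selectedSum-all []       = refl
  selectedSum-all (i ∷ js) = cong (2 ^ i +_) (selectedSum-all js)

  sum-map-filter : ∀ {P : Pred A 0ℓ} (P? : Decidable P) (g f : A → ℕ) xs →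
    (∀ x → P x → g x ≡ f x) → (∀ x → ¬ P x → f x ≡ 0) → sum (map g (filter P? xs)) ≡ sum (map f xs)
  sum-map-filter P? g f []       _      _      = refl
  sum-map-filter P? g f (x ∷ xs) on-P   off-P with P? x
  ... | yes px = cong₂ _+_ (on-P x px) (sum-map-filter P? g f xs on-P off-P)
  ... | no ¬px = trans (sum-map-filter P? g f xs on-P off-P) (cong (_+ sum (map f xs)) (sym (off-P x ¬px)))

  bits-⊆⇒essential : ∀ n j → 1 ≤ j → j < n → (∀ i → bit i j ≡ 1 → bit i n ≡ 1) → Essential n j
  bits-⊆⇒essential n j 1≤j j<n bits-⊆ = B , nonempty , proper , j≡ΣB
    where
    js : List ℕ
    js = binaryExponents n
    B : Vec Bool (length js)
    B = selectBits j js
    bitValue-off : ∀ x i → ¬ (bit i x ≡ 1) → bitValue i x ≡ 0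
    bitValue-off x i b≢1 = cong (λ b → if b then 2 ^ i else 0) (dec-false (bit i x ℕ.≟ 1) b≢1)
    j≡ΣB : j ≡ selectedSum js B
    j≡ΣB = sym (begin
      selectedSum js B                                   ≡⟨ selectedSum-selectBits j js ⟩
      sum (map (λ i → bitValue i j) js)                  ≡⟨ sum-map-filter _ _ _ (upTo n) (λ _ _ → refl)
                                                              (λ i b≢1 → bitValue-off j i (λ b≡1 → b≢1 (bits-⊆ i b≡1))) ⟩
      sum (map (λ i → bitValue i j) (upTo n))            ≡⟨ binary-expansion n j (ℕ.<-trans j<n (n<2^n n)) ⟩
      j                                                  ∎)
      where open ≡-Reasoning
    nonempty : NonemptySel B
    nonempty B≡∅ = ℕ.<⇒≢ 1≤j (sym (trans j≡ΣB (trans (cong (selectedSum js) B≡∅) (selectedSum-none js))))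
    proper : ProperSel B
    proper B≡all = ℕ.<⇒≢ j<n (begin
      j                                         ≡⟨ j≡ΣB ⟩
      selectedSum js B                          ≡⟨ cong (selectedSum js) B≡all ⟩
      selectedSum js (replicate _ true)         ≡⟨ selectedSum-all js ⟩
      sum (map (2 ^_) js)                       ≡⟨ sum-map-filter _ _ _ (upTo n)
                                                     (λ i b≡1 → sym (cong (λ b → if b then 2 ^ i else 0) (dec-true (bit i n ℕ.≟ 1) b≡1)))
                                                     (bitValue-off n) ⟩
      sum (map (λ i → bitValue i n) (upTo n))   ≡⟨ binary-expansion n n (n<2^n n) ⟩
      n                                         ∎)
      where open ≡-Reasoning

  ¬2∣⇒parity≡1ℙ : ∀ x → ¬ (2 ∣ x) → parity x ≡ 1ℙ
  ¬2∣⇒parity≡1ℙ zero          2∤x = ⊥-elim (2∤x (divides 0 refl))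
  ¬2∣⇒parity≡1ℙ (suc zero)    _   = refl
  ¬2∣⇒parity≡1ℙ (suc (suc x)) 2∤x = ¬2∣⇒parity≡1ℙ x (λ 2∣x → 2∤x (∣m∣n⇒∣m+n (divides 1 refl) 2∣x))

  nonessential⇒2∣C : ∀ n j → 1 ≤ j → j < n → ¬ Essential n j → 2 ∣ n C j
  nonessential⇒2∣C n j 1≤j j<n nonessential with 2 ∣? n C j
  ... | yes 2∣C = 2∣C
  ... | no  2∤C = ⊥-elim (nonessential (bits-⊆⇒essential n j 1≤j j<n
                    λ i → C-odd⇒bits-⊆ i n j (¬2∣⇒parity≡1ℙ (n C j) 2∤C)))

open import Defs
open import Data.Bool using (false)
open import Data.Empty using (⊥-elim)
open import Data.Integer using (ℤ; +_; _+_; _-_; -_; _%ℕ_; _/ℕ_)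
import Data.Integer as ℤ using (∣_∣)
open import Data.Integer.DivMod using (a≡a%ℕn+[a/ℕn]*n; n%ℕd<d)
open import Data.Integer.Divisibility.Signed using (∣ᵤ⇒∣; ∣⇒∣ᵤ; ∣m∣n⇒∣m+n; ∣m∣n⇒∣m-n; ∣m⇒∣-m; divides)
  renaming (_∣_ to _∣ℤ_)
import Data.Integer.Properties as ℤ
open import Data.Integer.Tactic.RingSolver using (solve-∀)
open import Data.List using (length; filter)
import Data.List.Properties as List
import Data.List.Relation.Unary.All as All
open import Data.Nat using (ℕ; _*_; _^_; _∸_; _≤_)
import Data.Nat as ℕ
import Data.Nat.DivMod as ℕ
import Data.Nat.Divisibility as ℕ
import Data.Nat.Properties as ℕ
open import Data.Nat.Combinatorics using (_C_)
open import Data.Nat.Divisibility using (_∣_)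
open import Data.Nat.GCD using (gcd)
open import Data.Nat.Primality using (Prime; euclidsLemma; prime?; prime⇒nonTrivial)
open import Data.Product using (_×_; ∃; _,_; swap)
open import Data.Rational using (½)
import Data.Rational as ℚ using (_/_; ↥_; ↧_)
import Data.Rational.Properties as ℚ
open import Data.Sum using (_⊎_; inj₁; inj₂)
open import Data.Unit using (⊤; tt)
open import Data.Vec using (replicate)
open import Relation.Binary.PropositionalEquality using (_≡_; refl; sym; trans; cong; cong₂; subst; module ≡-Reasoning)
open import Relation.Nullary using (¬_; Dec; yes; no)
open import Relation.Nullary.Decidable using (from-yes)

-- x ≡ y [mod m ] unfolds to m ∣ ∣ x - y ∣, from which Agda cannot infer x and y; hence the many
-- explicitly supplied implicit arguments below.

module _ {m : ℕ} where

  from-∣ℤ : ∀ {x y} → + m ∣ℤ (x - y) → x ≡ y [mod m ]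
  from-∣ℤ = ∣⇒∣ᵤ

  to-∣ℤ : ∀ {x y} → x ≡ y [mod m ] → + m ∣ℤ (x - y)
  to-∣ℤ = ∣ᵤ⇒∣

  mod-by : ∀ {x y} u v → x - y ≡ u + v → + m ∣ℤ u → + m ∣ℤ v → x ≡ y [mod m ]
  mod-by {x} {y} u v eq m∣u m∣v = from-∣ℤ {x} {y} (subst (+ m ∣ℤ_) (sym eq) (∣m∣n⇒∣m+n m∣u m∣v))

  mod-refl : ∀ x → x ≡ x [mod m ]
  mod-refl x = subst (λ d → m ∣ ℤ.∣ d ∣) (sym (ℤ.+-inverseʳ x)) (ℕ.divides 0 refl)

  mod-sym : ∀ {x y} → x ≡ y [mod m ] → y ≡ x [mod m ]
  mod-sym {x} {y} x≡y = from-∣ℤ {y} {x} (subst (+ m ∣ℤ_) (negate x y) (∣m⇒∣-m (to-∣ℤ {x} {y} x≡y)))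
    where
    negate : ∀ x y → - (x - y) ≡ y - x
    negate = solve-∀

  mod-trans : ∀ {x y z} → x ≡ y [mod m ] → y ≡ z [mod m ] → x ≡ z [mod m ]
  mod-trans {x} {y} {z} x≡y y≡z = mod-by {x} {z} (x - y) (y - z) (telescope x y z) (to-∣ℤ {x} {y} x≡y) (to-∣ℤ {y} {z} y≡z)
    where
    telescope : ∀ x y z → x - z ≡ (x - y) + (y - z)
    telescope = solve-∀

  mod-+ : ∀ {x x′ y y′} → x ≡ x′ [mod m ] → y ≡ y′ [mod m ] → (x + y) ≡ (x′ + y′) [mod m ]
  mod-+ {x} {x′} {y} {y′} x≡x′ y≡y′ = mod-by {x + y} {x′ + y′} (x - x′) (y - y′) (regroup x x′ y y′)
    (to-∣ℤ {x} {x′} x≡x′) (to-∣ℤ {y} {y′} y≡y′)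
    where
    regroup : ∀ x x′ y y′ → (x + y) - (x′ + y′) ≡ (x - x′) + (y - y′)
    regroup = solve-∀

  mod-complement : ∀ {x x′ c c′} → (x + x′) ≡ (+ 0) [mod m ] → (c + c′) ≡ (+ 0) [mod m ] →
    x ≡ c [mod m ] → x′ ≡ c′ [mod m ]
  mod-complement {x} {x′} {c} {c′} x+x′≡0 c+c′≡0 x≡c =
    mod-by {x′} {c′} ((x + x′) - + 0) (- ((c + c′) - + 0) - (x - c)) (rearrange x x′ c c′)
      (to-∣ℤ {x + x′} {+ 0} x+x′≡0) (∣m∣n⇒∣m-n (∣m⇒∣-m (to-∣ℤ {c + c′} {+ 0} c+c′≡0)) (to-∣ℤ {x} {c} x≡c))
    where
    rearrange : ∀ x x′ c c′ → x′ - c′ ≡ ((x + x′) - + 0) + (- ((c + c′) - + 0) - (x - c))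
    rearrange = solve-∀

mod-+-cancelʳ : ∀ {m} x y z → (x + z) ≡ (y + z) [mod m ] → x ≡ y [mod m ]
mod-+-cancelʳ {m} x y z x+z≡y+z = mod-by {m} {x} {y} ((x + z) - (y + z)) (+ 0) (rearrange x y z)
  (to-∣ℤ {m} {x + z} {y + z} x+z≡y+z) (divides (+ 0) refl)
  where
  rearrange : ∀ x y z → x - y ≡ ((x + z) - (y + z)) + + 0
  rearrange = solve-∀

mod-+-modulus : ∀ {m} x → x ≡ (x + + m) [mod m ]
mod-+-modulus {m} x = mod-by {m} {x} {x + + m} (- + m) (+ 0) (rearrange x (+ m))
  (∣m⇒∣-m (∣ᵤ⇒∣ {+ m} {+ m} ℕ.∣-refl)) (divides (+ 0) refl)
  where
  rearrange : ∀ x M → x - (x + M) ≡ - M + + 0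
  rearrange = solve-∀

mod-sum : ∀ {m} x x′ c c′ → x ≡ c [mod m ] → x′ ≡ c′ [mod m ] → (x + x′) ≡ (+ 0) [mod m ] →
  (c + c′) ≡ (+ 0) [mod m ]
mod-sum {m} x x′ c c′ x≡c x′≡c′ x+x′≡0 =
  mod-trans {m} {c + c′} {x + x′} {+ 0} (mod-sym {m} {x + x′} {c + c′} (mod-+ {m} {x} {c} {x′} {c′} x≡c x′≡c′)) x+x′≡0

mod-∣ : ∀ {d m x y} → d ∣ m → x ≡ y [mod m ] → x ≡ y [mod d ]
mod-∣ = ℕ.∣-trans

module _ {m : ℕ} where

  mod-zero : ∀ {x} → m ∣ ℤ.∣ x ∣ → x ≡ (+ 0) [mod m ]
  mod-zero {x} = subst (λ d → m ∣ ℤ.∣ d ∣) (sym (ℤ.+-identityʳ x))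

  mod-zero⁻¹ : ∀ {x} → x ≡ (+ 0) [mod m ] → m ∣ ℤ.∣ x ∣
  mod-zero⁻¹ {x} = subst (λ d → m ∣ ℤ.∣ d ∣) (ℤ.+-identityʳ x)

odd-≡-mod-2 : ∀ {x y} → ¬ (x ≡ (+ 0) [mod 2 ]) → ¬ (y ≡ (+ 0) [mod 2 ]) → x ≡ y [mod 2 ]
odd-≡-mod-2 {x} {y} x-odd y-odd = mod-by {2} {x} {y} ((x /ℕ 2 - y /ℕ 2) ℤ.* + 2) (+ 0)
  (trans (cong₂ _-_ (odd-form x x-odd) (odd-form y y-odd)) (difference (x /ℕ 2) (y /ℕ 2)))
  (divides (x /ℕ 2 - y /ℕ 2) refl) (divides (+ 0) refl)
  where
  odd-form : ∀ z → ¬ (z ≡ (+ 0) [mod 2 ]) → z ≡ + 1 + (z /ℕ 2) ℤ.* + 2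
  odd-form z z-odd with z %ℕ 2 | a≡a%ℕn+[a/ℕn]*n z 2 | n%ℕd<d z 2
  ... | 0 | z≡ | _ = ⊥-elim (z-odd (mod-zero {2} {z} (∣⇒∣ᵤ (divides (z /ℕ 2) (trans z≡ (ℤ.+-identityˡ _))))))
  ... | 1 | z≡ | _ = z≡
  ... | ℕ.suc (ℕ.suc _) | _ | ℕ.s≤s (ℕ.s≤s ())
  difference : ∀ u v → (+ 1 + u ℤ.* + 2) - (+ 1 + v ℤ.* + 2) ≡ (u - v) ℤ.* + 2 + + 0
  difference = solve-∀

mod-2-two-classes : ∀ {x y z} → ¬ (x ≡ z [mod 2 ]) → ¬ (y ≡ z [mod 2 ]) → x ≡ y [mod 2 ]
mod-2-two-classes {x} {y} {z} x≢z y≢z = mod-by {2} {x} {y} ((x - z) - (y - z)) (+ 0) (rearrange x y z)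
  (to-∣ℤ {2} {x - z} {y - z} (odd-≡-mod-2 {x - z} {y - z} (λ e → x≢z (mod-zero⁻¹ {2} {x - z} e)) (λ e → y≢z (mod-zero⁻¹ {2} {y - z} e))))
  (divides (+ 0) refl)
  where
  rearrange : ∀ x y z → x - y ≡ ((x - z) - (y - z)) + + 0
  rearrange = solve-∀

module _ {p : ℕ} (p-prime : Prime p) (p-odd : ¬ 2 ∣ p) where

  2∣-and-∣⇒2*p∣ : ∀ {d} → p ∣ d → 2 ∣ d → 2 * p ∣ d
  2∣-and-∣⇒2*p∣ (ℕ.divides c refl) 2∣cp with euclidsLemma c p (from-yes (prime? 2)) 2∣cp
  ... | inj₂ 2∣p = ⊥-elim (p-odd 2∣p)
  ... | inj₁ (ℕ.divides c′ refl) = ℕ.divides c′ (ℕ.*-assoc c′ 2 p)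

  mod-2p : ∀ {x y} → x ≡ y [mod p ] → x ≡ y [mod 2 ] → x ≡ y [mod 2 * p ]
  mod-2p = 2∣-and-∣⇒2*p∣

  double-≡0 : ∀ {x} → (x + x) ≡ (+ 0) [mod p ] → x ≡ (+ 0) [mod p ]
  double-≡0 {x} 2x≡0 with euclidsLemma 2 ℤ.∣ x ∣ p-prime (subst (p ∣_) ∣x+x∣≡2∣x∣ (mod-zero⁻¹ {p} {x + x} 2x≡0))
    where
    ∣x+x∣≡2∣x∣ : ℤ.∣ x + x ∣ ≡ 2 * ℤ.∣ x ∣
    ∣x+x∣≡2∣x∣ = trans (cong ℤ.∣_∣ (twice x)) (ℤ.abs-* (+ 2) x)
      where
      twice : ∀ x → x + x ≡ + 2 ℤ.* x
      twice = solve-∀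
  ... | inj₁ p∣2 = ⊥-elim (p-odd (subst (2 ∣_) (sym (ℕ.≤-antisym (ℕ.∣⇒≤ p∣2) (prime≥2 p-prime))) ℕ.∣-refl))
    where
    prime≥2 : ∀ {p} → Prime p → 2 ℕ.≤ p
    prime≥2 {p} p-prime = ℕ.nonTrivial⇒n>1 p {{prime⇒nonTrivial p-prime}}
  ... | inj₂ p∣x = mod-zero {p} {x} p∣x

  p≢0-mod-2 : ¬ ((+ p) ≡ (+ 0) [mod 2 ])
  p≢0-mod-2 2∣p = p-odd (mod-zero⁻¹ {2} {+ p} 2∣p)

double-cancel : ∀ x y → x ℕ.+ x ≡ y ℕ.+ y → x ≡ y
double-cancel x y x+x≡y+y = ℕ.*-cancelˡ-≡ x y 2 (trans (twice x) (trans x+x≡y+y (sym (twice y))))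
  where
  twice : ∀ z → 2 * z ≡ z ℕ.+ z
  twice z = cong (z ℕ.+_) (ℕ.+-identityʳ z)

4x≡2^N⇒ : ∀ N x → 2 * (x ℕ.+ x) ≡ 2 ^ N → x ≡ 2 ^ (N ∸ 2)
4x≡2^N⇒ 0                 x 4x≡1 = ⊥-elim (ℕ.even≢odd (x ℕ.+ x) 0 4x≡1)
4x≡2^N⇒ 1                 x 4x≡2 =
  ⊥-elim (ℕ.even≢odd x 0 (trans (cong (x ℕ.+_) (ℕ.+-identityʳ x)) (ℕ.*-cancelˡ-≡ (x ℕ.+ x) 1 2 4x≡2)))
4x≡2^N⇒ (ℕ.suc (ℕ.suc N)) x 4x≡2^N =
  double-cancel x (2 ^ N) (trans (ℕ.*-cancelˡ-≡ (x ℕ.+ x) (2 * 2 ^ N) 2 4x≡2^N) (cong (2 ^ N ℕ.+_) (ℕ.+-identityʳ _)))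

quarters : ∀ N x y → x ℕ.+ x ℕ.+ (y ℕ.+ y) ≡ 2 ^ N → 2 * (x ℕ.+ x) ≡ 2 ^ N ⊎ 2 * (y ℕ.+ y) ≡ 2 ^ N →
  x ≡ 2 ^ (N ∸ 2) × y ≡ 2 ^ (N ∸ 2)
quarters N x y total (inj₁ 4x≡2^N) = x≡ , trans (double-cancel y x y+y≡x+x) x≡
  where
  x≡ : x ≡ 2 ^ (N ∸ 2)
  x≡ = 4x≡2^N⇒ N x 4x≡2^N
  y+y≡x+x : y ℕ.+ y ≡ x ℕ.+ x
  y+y≡x+x = ℕ.+-cancelˡ-≡ (x ℕ.+ x) _ _
    (trans total (trans (sym 4x≡2^N) (cong (λ z → x ℕ.+ x ℕ.+ z) (ℕ.+-identityʳ (x ℕ.+ x)))))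
quarters N x y total (inj₂ 4y≡2^N) =
  swap (quarters N y x (trans (ℕ.+-comm (y ℕ.+ y) (x ℕ.+ x)) total) (inj₁ 4y≡2^N))

/≡½⇒ : ∀ c d .{{_ : ℕ.NonZero d}} → (+ c) ℚ./ d ≡ ½ → 2 * c ≡ d
/≡½⇒ c d c/d≡½ = ℤ.+-injective (trans (ℤ.pos-* 2 c) (trans (cong (+ 2 ℤ.*_) (sym gcd≡c)) denominator))
  where
  gcd≡c : + gcd c d ≡ + c
  gcd≡c = trans (sym (ℤ.*-identityˡ (+ gcd c d))) (trans (cong (ℤ._* + gcd c d) (sym (cong ℚ.↥_ c/d≡½))) (ℚ.↥-/ (+ c) d))
  denominator : + 2 ℤ.* + gcd c d ≡ + d
  denominator = trans (cong (ℤ._* + gcd c d) (sym (cong ℚ.↧_ c/d≡½))) (ℚ.↧-/ (+ c) d)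

ρ≡½⇒ : ∀ n → ρ n ≡ ½ → 2 * countOdd n ≡ 2 ^ (n ∸ 1)
ρ≡½⇒ n = /≡½⇒ (countOdd n) (2 ^ (n ∸ 1)) {{ℕ.m^n≢0 2 (n ∸ 1)}}

subsets-enumerate : ∀ n → Combinatorics.Enumerates (allSubsets n)
subsets-enumerate n = Combinatorics.allVecs-enumerates Combinatorics.Bool-enumerates (ℕ.pred n)

countCong-complement : ∀ n (flip : SubsetOf[n-1] n → SubsetOf[n-1] n) → (∀ S → flip (flip S) ≡ S) →
  ∀ {m} → (∀ S → ((+ β n S) + (+ β n (flip S))) ≡ (+ 0) [mod m ]) →
  ∀ c c′ → (c + c′) ≡ (+ 0) [mod m ] → countCong n c m ≡ countCong n c′ m
countCong-complement n flip flip-involutive {m} pairs c c′ c+c′≡0 =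
  Combinatorics.length-filter-involution (subsets-enumerate n) flip flip-involutive _ _
    (λ S → mod-complement {m} {+ β n S} {+ β n (flip S)} {c} {c′} (pairs S) c+c′≡0)
    (λ S → mod-complement {m} {+ β n S} {+ β n (flip S)} {c′} {c} (pairs S) (subst (λ d → d ≡ (+ 0) [mod m ]) (ℤ.+-comm c c′) c+c′≡0))

module TwoClasses {p : ℕ} (p-prime : Prime p) (p-odd : ¬ 2 ∣ p) (n : ℕ) (a b : ℤ)
  (a≢0 : ¬ (a ≡ (+ 0) [mod p ])) (b≢0 : ¬ (b ≡ (+ 0) [mod p ])) (a≡b : a ≡ b [mod 2 ])
  (classes : ∀ S → ((+ β n S) ≡ a [mod p ]) ⊎ ((+ β n S) ≡ b [mod p ]))
  (flip : SubsetOf[n-1] n → SubsetOf[n-1] n) (flip-involutive : ∀ S → flip (flip S) ≡ S)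
  (pairs : ∀ S → ((+ β n S) + (+ β n (flip S))) ≡ (+ 0) [mod 2 * p ])
  where

  private
    P : ℤ
    P = + p

    p∣2p : p ∣ 2 * p
    p∣2p = ℕ.n∣m*n 2

    2∣2p : 2 ∣ 2 * p
    2∣2p = ℕ.m∣m*n p

  a+b≡0 : (a + b) ≡ (+ 0) [mod 2 * p ]
  a+b≡0 = mod-2p p-prime p-odd {a + b} {+ 0} a+b≡0-mod-p a+b≡0-mod-2
    where
    S₀ : SubsetOf[n-1] n
    S₀ = replicate _ false
    x x′ : ℤ
    x = + β n S₀
    x′ = + β n (flip S₀)
    x+x′≡0 : (x + x′) ≡ (+ 0) [mod p ]
    x+x′≡0 = mod-∣ {p} {2 * p} {x + x′} {+ 0} p∣2p (pairs S₀)
    -- x and x′ cannot lie in the same class, since p ∤ 2a and p ∤ 2b.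
    a+b≡0-mod-p : (a + b) ≡ (+ 0) [mod p ]
    a+b≡0-mod-p with classes S₀ | classes (flip S₀)
    ... | inj₁ x≡a | inj₁ x′≡a = ⊥-elim (a≢0 (double-≡0 p-prime p-odd {a} (mod-sum x x′ a a x≡a x′≡a x+x′≡0)))
    ... | inj₁ x≡a | inj₂ x′≡b = mod-sum x x′ a b x≡a x′≡b x+x′≡0
    ... | inj₂ x≡b | inj₁ x′≡a = subst (λ d → d ≡ (+ 0) [mod p ]) (ℤ.+-comm b a) (mod-sum x x′ b a x≡b x′≡a x+x′≡0)
    ... | inj₂ x≡b | inj₂ x′≡b = ⊥-elim (b≢0 (double-≡0 p-prime p-odd {b} (mod-sum x x′ b b x≡b x′≡b x+x′≡0)))
    a+b≡0-mod-2 : (a + b) ≡ (+ 0) [mod 2 ]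
    a+b≡0-mod-2 = mod-trans {2} {a + b} {b + b} {+ 0} (mod-+ {2} {a} {b} {b} {b} a≡b (mod-refl b))
      (mod-zero {2} {b + b} (∣⇒∣ᵤ (divides b (twice b))))
      where
      twice : ∀ b → b + b ≡ b ℤ.* + 2
      twice = solve-∀

  countCong-a≡b : countCong n a (2 * p) ≡ countCong n b (2 * p)
  countCong-a≡b = countCong-complement n flip flip-involutive pairs a b a+b≡0

  countCong-a+p≡b+p : countCong n (a + P) (2 * p) ≡ countCong n (b + P) (2 * p)
  countCong-a+p≡b+p = countCong-complement n flip flip-involutive pairs (a + P) (b + P)
    (mod-by {2 * p} {(a + P) + (b + P)} {+ 0} ((a + b) - + 0) (+ (2 * p)) shift
      (to-∣ℤ {2 * p} {a + b} {+ 0} a+b≡0) (∣ᵤ⇒∣ {+ (2 * p)} {+ (2 * p)} ℕ.∣-refl))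
    where
    shift : ((a + P) + (b + P)) - + 0 ≡ ((a + b) - + 0) + + (2 * p)
    shift = trans (rearrange a b P) (cong (λ d → ((a + b) - + 0) + d) (sym (ℤ.pos-* 2 p)))
      where
      rearrange : ∀ a b P → ((a + P) + (b + P)) - + 0 ≡ ((a + b) - + 0) + + 2 ℤ.* P
      rearrange = solve-∀

  a≢b : ¬ (a ≡ b [mod p ])
  a≢b a≡b[p] = a≢0 (double-≡0 p-prime p-odd {a}
    (mod-trans {p} {a + a} {a + b} {+ 0} (mod-+ {p} {a} {a} {a} {b} (mod-refl a) a≡b[p])
                                         (mod-∣ {p} {2 * p} {a + b} {+ 0} p∣2p a+b≡0)))

  countCong-pair : ∀ c d → c ≡ d [mod 2 ] → ¬ (c ≡ d [mod p ]) →
    (∀ S → ((+ β n S) ≡ c [mod p ]) ⊎ ((+ β n S) ≡ d [mod p ])) →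
    countCong n c (2 * p) ℕ.+ countCong n d (2 * p) ≡ countCong n c 2
  countCong-pair c d c≡d c≢d classes′ = Combinatorics.length-filter-⊎ _ _ _ split join disjoint (allSubsets n)
    where
    split : ∀ S → (+ β n S) ≡ c [mod 2 ] → ((+ β n S) ≡ c [mod 2 * p ]) ⊎ ((+ β n S) ≡ d [mod 2 * p ])
    split S β≡c[2] with classes′ S
    ... | inj₁ β≡c[p] = inj₁ (mod-2p p-prime p-odd {+ β n S} {c} β≡c[p] β≡c[2])
    ... | inj₂ β≡d[p] = inj₂ (mod-2p p-prime p-odd {+ β n S} {d} β≡d[p] (mod-trans {2} {+ β n S} {c} {d} β≡c[2] c≡d))
    join : ∀ S → ((+ β n S) ≡ c [mod 2 * p ]) ⊎ ((+ β n S) ≡ d [mod 2 * p ]) → (+ β n S) ≡ c [mod 2 ]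
    join S (inj₁ β≡c) = mod-∣ {2} {2 * p} {+ β n S} {c} 2∣2p β≡c
    join S (inj₂ β≡d) = mod-trans {2} {+ β n S} {d} {c} (mod-∣ {2} {2 * p} {+ β n S} {d} 2∣2p β≡d) (mod-sym {2} {c} {d} c≡d)
    disjoint : ∀ S → (+ β n S) ≡ c [mod 2 * p ] → ¬ ((+ β n S) ≡ d [mod 2 * p ])
    disjoint S β≡c β≡d = c≢d (mod-trans {p} {c} {+ β n S} {d} (mod-sym {p} {+ β n S} {c} (mod-∣ {p} {2 * p} {+ β n S} {c} p∣2p β≡c))
                                                              (mod-∣ {p} {2 * p} {+ β n S} {d} p∣2p β≡d))

  a+P≢a : ¬ ((a + P) ≡ a [mod 2 ])
  a+P≢a a+P≡a = p≢0-mod-2 p-prime p-odd (mod-by {2} {P} {+ 0} ((a + P) - a) (+ 0) (rearrange a P)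
    (to-∣ℤ {2} {a + P} {a} a+P≡a) (divides (+ 0) refl))
    where
    rearrange : ∀ a P → P - + 0 ≡ ((a + P) - a) + + 0
    rearrange = solve-∀

  parity-split : countCong n a 2 ℕ.+ countCong n (a + P) 2 ≡ 2 ^ (n ∸ 1)
  parity-split = begin
    countCong n a 2 ℕ.+ countCong n (a + P) 2
      ≡⟨ Combinatorics.length-filter-⊎ _ _ (λ _ → yes tt) cover (λ _ _ → tt) disjoint (allSubsets n) ⟩
    length (filter (λ _ → yes tt) (allSubsets n))
      ≡⟨ cong length (List.filter-all (λ _ → yes tt) (All.universal _ (allSubsets n))) ⟩
    length (allSubsets n)
      ≡⟨ Combinatorics.length-allVecs _ (ℕ.pred n) ⟩
    2 ^ ℕ.pred n
      ≡⟨ cong (2 ^_) (pred≡∸1 n) ⟩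
    2 ^ (n ∸ 1)
      ∎
    where
    open ≡-Reasoning
    pred≡∸1 : ∀ n → ℕ.pred n ≡ n ∸ 1
    pred≡∸1 0           = refl
    pred≡∸1 (ℕ.suc n) = refl
    cover : ∀ S → ⊤ → ((+ β n S) ≡ a [mod 2 ]) ⊎ ((+ β n S) ≡ (a + P) [mod 2 ])
    cover S _ with (+ β n S) ≡? a [mod 2 ]
    ... | yes β≡a = inj₁ β≡a
    ... | no  β≢a = inj₂ (mod-2-two-classes {+ β n S} {a + P} {a} β≢a a+P≢a)
    disjoint : ∀ S → (+ β n S) ≡ a [mod 2 ] → ¬ ((+ β n S) ≡ (a + P) [mod 2 ])
    disjoint S β≡a β≡a+P = a+P≢a (mod-trans {2} {a + P} {+ β n S} {a} (mod-sym {2} {+ β n S} {a + P} β≡a+P) β≡a)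

  countOdd≡countCong : ∀ c → ¬ (c ≡ (+ 0) [mod 2 ]) → countOdd n ≡ countCong n c 2
  countOdd≡countCong c c-odd = cong length (List.filter-≐ _ _ (to , from) (allSubsets n))
    where
    to : ∀ {S} → β n S ℕ.% 2 ≡ 1 → (+ β n S) ≡ c [mod 2 ]
    to {S} β-odd = mod-2-two-classes {+ β n S} {c} {+ 0}
      (λ β≡0 → ℕ.0≢1+n (trans (sym (ℕ.n∣m⇒m%n≡0 (β n S) 2 (mod-zero⁻¹ {2} {+ β n S} β≡0))) β-odd)) c-odd
    from : ∀ {S} → (+ β n S) ≡ c [mod 2 ] → β n S ℕ.% 2 ≡ 1
    from {S} β≡c with β n S ℕ.% 2 in β%2 | ℕ.m%n<n (β n S) 2
    ... | 0 | _ = ⊥-elim (c-odd (mod-trans {2} {c} {+ β n S} {+ 0} (mod-sym {2} {+ β n S} {c} β≡c)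
                    (mod-zero {2} {+ β n S} (ℕ.m%n≡0⇒n∣m (β n S) 2 β%2))))
    ... | 1 | _ = refl
    ... | ℕ.suc (ℕ.suc _) | ℕ.s≤s (ℕ.s≤s ())

  quarter-counts : 2 * countOdd n ≡ 2 ^ (n ∸ 1) →
    countCong n a (2 * p) ≡ 2 ^ (n ∸ 3) × countCong n (a + P) (2 * p) ≡ 2 ^ (n ∸ 3)
  quarter-counts 2odd≡total = subst (λ e → A ≡ 2 ^ e × A′ ≡ 2 ^ e) (ℕ.∸-+-assoc n 1 2)
    (quarters (n ∸ 1) A A′ total (odd-half ((a ≡? (+ 0) [mod 2 ]))))
    where
    A A′ : ℕ
    A = countCong n a (2 * p)
    A′ = countCong n (a + P) (2 * p)
    A+A≡ : A ℕ.+ A ≡ countCong n a 2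
    A+A≡ = trans (cong (A ℕ.+_) countCong-a≡b) (countCong-pair a b a≡b a≢b classes)
    shifted-classes : ∀ S → ((+ β n S) ≡ (a + P) [mod p ]) ⊎ ((+ β n S) ≡ (b + P) [mod p ])
    shifted-classes S with classes S
    ... | inj₁ β≡a = inj₁ (mod-trans {p} {+ β n S} {a} {a + P} β≡a (mod-+-modulus a))
    ... | inj₂ β≡b = inj₂ (mod-trans {p} {+ β n S} {b} {b + P} β≡b (mod-+-modulus b))
    A′+A′≡ : A′ ℕ.+ A′ ≡ countCong n (a + P) 2
    A′+A′≡ = trans (cong (A′ ℕ.+_) countCong-a+p≡b+p)
      (countCong-pair (a + P) (b + P) (mod-+ {2} {a} {b} {P} {P} a≡b (mod-refl P))
        (λ a+P≡b+P → a≢b (mod-+-cancelʳ a b P a+P≡b+P)) shifted-classes)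
    total : A ℕ.+ A ℕ.+ (A′ ℕ.+ A′) ≡ 2 ^ (n ∸ 1)
    total = trans (cong₂ ℕ._+_ A+A≡ A′+A′≡) parity-split
    odd-half : Dec (a ≡ (+ 0) [mod 2 ]) → 2 * (A ℕ.+ A) ≡ 2 ^ (n ∸ 1) ⊎ 2 * (A′ ℕ.+ A′) ≡ 2 ^ (n ∸ 1)
    odd-half (no a-odd)  = inj₁ (trans (cong (2 *_) (trans A+A≡ (sym (countOdd≡countCong a a-odd)))) 2odd≡total)
    odd-half (yes a-even) = inj₂ (trans (cong (2 *_) (trans A′+A′≡ (sym (countOdd≡countCong (a + P) a+P-odd)))) 2odd≡total)
      where
      a+P-odd : ¬ ((a + P) ≡ (+ 0) [mod 2 ])
      a+P-odd a+P-even = a+P≢a (mod-trans {2} {a + P} {+ 0} {a} a+P-even (mod-sym {2} {a} {+ 0} a-even))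

theorem5p4 : (p t r : ℕ) → Prime p → ¬ (2 ∣ p) → 1 ≤ r →
    let q = p ^ t
        n = r * q
    in (∃ λ j → In[n-1] n j × ¬ Essential n j × ¬ (q ∣ j)) →
       (a b : ℤ) → ¬ (a ≡ + 0 [mod p ]) → ¬ (b ≡ + 0 [mod p ]) → a ≡ b [mod 2 ] →
       ((S : SubsetOf[n-1] n) → ((+ β n S) ≡ a [mod p ]) ⊎ ((+ β n S) ≡ b [mod p ])) →
       (countCong n a (2 * p) ≡ countCong n b (2 * p))
       × (countCong n (a + + p) (2 * p) ≡ countCong n (b + + p) (2 * p))
       × (ρ n ≡ ½ →
            (countCong n a (2 * p) ≡ 2 ^ (n ∸ 3))
            × (countCong n b (2 * p) ≡ 2 ^ (n ∸ 3))
            × (countCong n (a + + p) (2 * p) ≡ 2 ^ (n ∸ 3))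
            × (countCong n (b + + p) (2 * p) ≡ 2 ^ (n ∸ 3)))
theorem5p4 p t r p-prime p-odd _ (j , (1≤j , j<n) , nonessential , pᵗ∤j) a b a≢0 b≢0 a≡b classes =
  countCong-a≡b , countCong-a+p≡b+p , λ ρ≡½ →
    let A≡ , A′≡ = quarter-counts (ρ≡½⇒ n ρ≡½)
    in A≡ , trans (sym countCong-a≡b) A≡ , A′≡ , trans (sym countCong-a+p≡b+p) A′≡
  where
  n : ℕ
  n = r * p ^ t
  flip : SubsetOf[n-1] n → SubsetOf[n-1] n
  flip = Combinatorics.flipAt (j ∸ 1)
  2p∣C : 2 * p ∣ n C j
  2p∣C = 2∣-and-∣⇒2*p∣ p-prime p-odd (Combinatorics.prime∣C p-prime t n j (ℕ.divides r refl) 1≤j pᵗ∤j)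
                                   (Combinatorics.nonessential⇒2∣C n j 1≤j j<n nonessential)
  pairs : ∀ S → ((+ β n S) + (+ β n (flip S))) ≡ (+ 0) [mod 2 * p ]
  pairs S with X , β+β′≡ ← Combinatorics.β+β-flipAt n j 1≤j j<n S =
    mod-zero {2 * p} {(+ β n S) + (+ β n (flip S))} (subst (2 * p ∣_) (sym β+β′≡) (ℕ.∣m⇒∣m*n X 2p∣C))
  open TwoClasses p-prime p-odd n a b a≢0 b≢0 a≡b classes flip (Combinatorics.flipAt-involutive (j ∸ 1)) pairs
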